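{- Let $G$ be an st-digraph (C-DPP instance). Then: 1. If it is not the case that both $s$ and $t$ have at least one incoming and at least one outgoing arc in $G$, then $\mathrm{tFC}(G)$ is satisfiable. 2. Every minimally unsatisfiable subset $F' \subseteq \mathrm{tFC}(G)$ satisfies $\mathrm{vdeg}_{F'}(x_0) = 4$. 3. $G$ has a special closed walk iff $\mathrm{tFC}(G)$ is unsatisfiable. 4. $G$ has a special cycle iff some minimally unsatisfiable subset of $\mathrm{tFC}(G)$ belongs to Family III. 5. If $G$ does not have a special cycle, then every minimally unsatisfiable subset $F'$ of $\mathrm{tFC}(G)$ has deficiency $\delta(F') \ge 2$.
   Context: Literals are variables and their complements ($\overline{\overline x}=x$); clauses are finite sets of literals without complementary pair; clause-sets are finite sets of clauses. For a clause-set $F$: $\mathrm{ldeg}_F(x)$ is the number of clauses containing literal $x$, $\mathrm{vdeg}_F(v)=\mathrm{ldeg}_F(v)+\mathrm{ldeg}_F(\overline v)$, $n(F)$ the number of variables, $c(F)=|F|$, deficiency $\delta(F)=c(F)-n(F)$, $n_k(F)$ the number of variables $v$ with $\mathrm{vdeg}_F(v)=k$. $F$ is minimally unsatisfiable (MU) if unsatisfiable and every $F\setminus\{C\}$, $C\in F$, is satisfiable; a minimally unsatisfiable subset (MUS) of $F$ is a subset of $F$ that is MU. Family III is the class of MU clause-sets $F$ with all clauses of length $\le 2$ and with $n_3(F)=0$ and $n_4(F)=1$. Fix three distinct variables $s,t,x_0$. An st-digraph is a digraph $G$ (no loops) whose vertices are variables, with $s,t\in V(G)$, $x_0\notin V(G)$,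 and with neither $(s,t)$ nor $(t,s)$ an arc. Define $\tau(s)=x_0$, $\tau(t)=\overline{x_0}$, $\tau(v)=v$ otherwise; for an arc $(a,b)$ let $\tau((a,b))$ be the clause $\{\overline{\tau(a)},\tau(b)\}$; and $\mathrm{tFC}(G)=\{\tau(e): e\in E(G)\}$. $G$ has a special closed walk if there are a directed path $P_1$ from $s$ to $t$ and a directed path $P_2$ from $t$ to $s$; it has a special cycle if such paths exist with $V(P_1)\cap V(P_2)=\{s,t\}$. -}

module Defs where

open import Data.Bool using (Bool; true; false; not)
import Data.Bool as Bool
open import Data.Nat using (ℕ; _≤_)
import Data.Nat as ℕ
open import Data.Integer using (ℤ; +_; _-_)
open import Data.Fin using (Fin)
open import Data.Product using (Σ; ∃; ∃-syntax; _×_; _,_; proj₁; proj₂)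
open import Data.Product.Properties using (≡-dec)
open import Data.Sum using (_⊎_)
open import Data.List using (List; []; _∷_; length; map; filter; concatMap; deduplicate; removeAt)
open import Data.List.Relation.Unary.All using (All)
open import Data.List.Relation.Unary.Any using (Any)
open import Data.List.Relation.Unary.AllPairs using (AllPairs)
open import Data.List.Relation.Unary.Unique.Propositional using (Unique)
open import Data.List.Membership.Propositional using (_∈_; _∉_)
open import Data.List.Relation.Binary.Subset.Propositional using (_⊆_)
import Data.List.Membership.DecPropositional as DecMem
open import Relation.Binary.PropositionalEquality using (_≡_; _≢_)
open import Relation.Binary.Definitions using (DecidableEquality)
open import Relation.Nullary using (¬_)

Var : Set
Var = ℕ

Lit : Set
Lit = Bool × Var

pos neg : Var → Lit
pos v = (true , v)
neg v = (false , v)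

var : Lit → Var
var = proj₂

compl : Lit → Lit
compl (b , v) = (not b , v)

_≟L_ : DecidableEquality Lit
_≟L_ = ≡-dec Bool._≟_ ℕ._≟_

open DecMem _≟L_ using () renaming (_∈?_ to _∈L?_)

-- A clause is represented by a list of literals; it denotes the finite set
-- of its elements.  Well-formedness: no repetitions, no complementary pair.
Clause : Set
Clause = List Lit

IsClause : Clause → Set
IsClause C = Unique C × (∀ x → x ∈ C → compl x ∉ C)

_≈C_ : Clause → Clause → Set
C ≈C D = C ⊆ D × D ⊆ C

-- A clause-set is a list of clauses; it denotes the finite set of its
-- elements.  Well-formedness: each entry a clause, no two entries equal as sets.
ClauseSet : Set
ClauseSet = List Clause

IsClauseSet : ClauseSet → Set
IsClauseSet F = All IsClause F × AllPairs (λ C D → ¬ (C ≈C D)) F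

_⊆CS_ : ClauseSet → ClauseSet → Set
F ⊆CS G = All (λ C → Any (λ D → C ≈C D) G) F

Assignment : Set
Assignment = Var → Bool

litVal : Assignment → Lit → Bool
litVal φ (b , v) = if b then φ v else not (φ v)
  where open Data.Bool using (if_then_else_)

SatClause : Assignment → Clause → Set
SatClause φ C = Any (λ x → litVal φ x ≡ true) C

Satisfiable : ClauseSet → Set
Satisfiable F = ∃[ φ ] All (SatClause φ) F

MU : ClauseSet → Set
MU F = IsClauseSet F × ¬ Satisfiable F × (∀ (i : Fin (length F)) → Satisfiable (removeAt F i))

IsMUS : ClauseSet → ClauseSet → Set
IsMUS F' F = F' ⊆CS F × MU F'

ldeg : ClauseSet → Lit → ℕ
ldeg F x = length (filter (λ C → x ∈L? C) F)

vdeg : ClauseSet → Var → ℕ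
vdeg F v = ldeg F (pos v) ℕ.+ ldeg F (neg v)

vars : ClauseSet → List Var
vars F = deduplicate ℕ._≟_ (concatMap (map var) F)

nVars : ClauseSet → ℕ
nVars F = length (vars F)

cClauses : ClauseSet → ℕ
cClauses F = length F

deficiency : ClauseSet → ℤ
deficiency F = + cClauses F - + nVars F

nDeg : ℕ → ClauseSet → ℕ
nDeg k F = length (filter (λ v → vdeg F v ℕ.≟ k) (vars F))

FamilyIII : ClauseSet → Set
FamilyIII F = MU F × All (λ C → length C ≤ 2) F × nDeg 3 F ≡ 0 × nDeg 4 F ≡ 1

record Digraph : Set where
  field
    V : List Var
    E : List (Var × Var)
open Digraph public

IsStDigraph : (s t x₀ : Var) → Digraph → Set
IsStDigraph s t x₀ G =
  Unique (V G) × Unique (E G) ×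
  (∀ a b → (a , b) ∈ E G → a ≢ b × a ∈ V G × b ∈ V G) ×
  s ∈ V G × t ∈ V G × x₀ ∉ V G ×
  (s , t) ∉ E G × (t , s) ∉ E G

data Walk (G : Digraph) : Var → Var → List Var → Set where
  here : ∀ {a} → Walk G a a (a ∷ [])
  step : ∀ {a b c p} → (a , b) ∈ E G → Walk G b c p → Walk G a c (a ∷ p)

IsPath : Digraph → Var → Var → List Var → Set
IsPath G a b p = Walk G a b p × Unique p

SpecialClosedWalk : (s t : Var) → Digraph → Set
SpecialClosedWalk s t G =
  ∃[ p₁ ] ∃[ p₂ ] IsPath G s t p₁ × IsPath G t s p₂

SpecialCycle : (s t : Var) → Digraph → Set
SpecialCycle s t G =
  ∃[ p₁ ] ∃[ p₂ ] IsPath G s t p₁ × IsPath G t s p₂ ×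
    (∀ v → v ∈ p₁ → v ∈ p₂ → v ≡ s ⊎ v ≡ t)

HasIn HasOut : Digraph → Var → Set
HasIn G v = ∃[ a ] (a , v) ∈ E G
HasOut G v = ∃[ b ] (v , b) ∈ E G

τ : (s t x₀ : Var) → Var → Lit
τ s t x₀ v with v ℕ.≟ s | v ℕ.≟ t
... | Relation.Nullary.yes _ | _ = pos x₀
... | Relation.Nullary.no _ | Relation.Nullary.yes _ = neg x₀
... | Relation.Nullary.no _ | Relation.Nullary.no _ = pos v

τArc : (s t x₀ : Var) → Var × Var → Clause
τArc s t x₀ (a , b) = compl (τ s t x₀ a) ∷ τ s t x₀ b ∷ []

tFC : (s t x₀ : Var) → Digraph → ClauseSet
tFC s t x₀ G = map (τArc s t x₀) (E G)

module Submission where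

-- Read an arc (a , b) as the implication τ a ⇒ τ b; truth then propagates along walks, and
-- s, t are sent to x₀, ¬x₀.  A special closed walk therefore yields x₀ ⇒ ¬x₀ ⇒ x₀, while if t
-- is unreachable from s (or s from t) the set of reachable vertices, with x₀ given the value
-- of s, is a satisfying assignment.  Consequently every minimally unsatisfiable F′ ⊆ tFC(G)
-- is, up to set equality of clauses, the translation of the arc set H of a path P₁ from s to t
-- and a path P₂ from t to s, and all counts are read off H: x₀ occurs exactly in the first and
-- last arcs of both paths, and an inner vertex lying on one path only has degree 2.  If the
-- paths meet in an inner vertex, the first such vertex u along P₁ is entered by different arcs
-- of P₁ and P₂, so u has degree 3 or 4; as every vertex is the target of an arc of H and u of
-- two, c(F′) = |H| ≥ n(F′) + 2.  If they do not meet, tFC(H) is minimally unsatisfiable: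
-- without the clause of an arc of P₁ (say), the vertices of P₁ before that arc form a closed
-- set containing s but not t.

open import Defs
open import Data.Bool using (Bool; true; false; not; T; T?; _∨_; _∧_; if_then_else_)
open import Data.Bool.Properties using (¬-not; T-∨; T-∧; T-≡; not-injective; not-involutive)
open import Data.Empty using (⊥; ⊥-elim)
open import Data.Fin using (Fin; zero; suc; cast)
open import Data.Fin.Properties using (cast-involutive)
open import Data.Integer using (+_; +≤+) renaming (_≤_ to _≤ℤ_)
open import Data.Integer.Properties using ([+m]-[+n]≡m⊖n; ⊖-≥)
open import Data.List using (List; []; _∷_; _++_; length; map; filter; lookup; removeAt; deduplicate; concatMap)
open import Data.List.Properties using (length-removeAt′; length-map; map-removeAt)
open import Data.List.Membership.Propositional using (_∈_; _∉_; find; lose)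
open import Data.List.Membership.Propositional.Properties
  using (∈-map⁺; ∈-map⁻; ∈-++⁺ˡ; ∈-++⁺ʳ; ∈-++⁻; ∈-filter⁺; ∈-filter⁻; ∈-deduplicate⁺; ∈-deduplicate⁻;
         ∈-concatMap⁺; ∈-concatMap⁻; ∈-lookup)
import Data.List.Membership.DecPropositional as DecMembership
import Data.List.Membership.Setoid as SetoidMembership
import Data.List.Membership.Setoid.Properties as SetoidMembershipₚ
open import Data.List.Relation.Binary.Subset.Propositional using (_⊆_)
open import Data.List.Relation.Binary.Subset.Propositional.Properties using (⊆-refl; ⊆-trans; Any-resp-⊆)
import Data.List.Relation.Binary.Subset.DecPropositional as DecSubset
import Data.List.Relation.Binary.Subset.Setoid as SetoidSubset
open import Data.List.Relation.Unary.All as All using (All; []; _∷_)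
import Data.List.Relation.Unary.All.Properties as Allₚ
open import Data.List.Relation.Unary.AllPairs using ([]; _∷_)
open import Data.List.Relation.Unary.Any as Any using (Any; here; there; any?)
import Data.List.Relation.Unary.Any.Properties as Anyₚ
open import Data.List.Relation.Unary.Unique.Propositional using (Unique)
import Data.List.Relation.Unary.Unique.Propositional.Properties as Uniqueₚ
open import Data.List.Relation.Unary.Unique.DecPropositional.Properties using (deduplicate-!)
import Data.List.Relation.Unary.Unique.Setoid as SetoidUnique
import Data.List.Relation.Unary.Unique.Setoid.Properties as SetoidUniqueₚ
open import Data.Nat using (ℕ; suc; _+_; _≤_; z≤n; s≤s)
import Data.Nat as ℕ
open import Data.Nat.Properties
  using (≤-refl; ≤-trans; ≤-reflexive; ≤-antisym; +-monoʳ-≤; n≤0⇒n≡0; m+n≤o⇒n≤o; m+n≤o⇒m≤o∸n;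
         module ≤-Reasoning)
open import Data.Product using (Σ-syntax; ∃-syntax; _×_; _,_; proj₁; proj₂)
import Data.Product as Product
open import Data.Product.Properties using (≡-dec)
open import Data.Sum using (_⊎_; inj₁; inj₂; [_,_])
import Data.Sum as Sum
open import Function using (_∘_; id)
open import Function.Bundles using (Equivalence; _⇔_; mk⇔)
open import Level using (0ℓ)
open import Relation.Binary.Bundles using (Setoid)
open import Relation.Binary.Definitions using (DecidableEquality)
open import Relation.Binary.PropositionalEquality using (_≡_; _≢_; refl; sym; trans; cong; cong₂; subst; ≢-sym)
import Relation.Binary.PropositionalEquality as ≡
open import Relation.Nullary using (¬_; Dec; yes; no; contradiction)
open import Relation.Nullary.Decidable
  using (⌊_⌋; isNo; toWitness; fromWitness; fromWitnessFalse; decidable-stable; ¬?; _⊎-dec_; _×-dec_)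

open Equivalence using (to; from)
open DecMembership ℕ._≟_ using (_∈?_)
open DecMembership _≟L_ using () renaming (_∈?_ to _∈L?_)

module _ {c ℓ} (S : Setoid c ℓ) where
  open Setoid S using (_≈_) renaming (refl to ≈-refl; sym to ≈-sym; trans to ≈-trans)
  open SetoidMembership S using () renaming (_∈_ to _∈ₛ_)
  open SetoidSubset S using () renaming (_⊆_ to _⊆ₛ_)
  open SetoidUnique S using () renaming (Unique to Uniqueₛ)

  ∈-removeAt⁺ : ∀ {x y ys} (x∈ys : x ∈ₛ ys) → y ∈ₛ ys → ¬ x ≈ y → y ∈ₛ removeAt ys (Any.index x∈ys)
  ∈-removeAt⁺ (here x≈z) (here y≈z) x≉y = ⊥-elim (x≉y (≈-trans x≈z (≈-sym y≈z)))
  ∈-removeAt⁺ (here _) (there y∈ys) _ = y∈ys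
  ∈-removeAt⁺ (there _) (here y≈z) _ = here y≈z
  ∈-removeAt⁺ (there x∈ys) (there y∈ys) x≉y = there (∈-removeAt⁺ x∈ys y∈ys x≉y)

  Unique⇒length-≤ : ∀ {xs ys} → Uniqueₛ xs → xs ⊆ₛ ys → length xs ≤ length ys
  Unique⇒length-≤ [] _ = z≤n
  Unique⇒length-≤ {x ∷ xs} {ys} (x≉xs ∷ !xs) xs⊆ys = begin
    suc (length xs)              ≤⟨ s≤s (Unique⇒length-≤ !xs xs⊆ys∖x) ⟩
    suc (length (removeAt ys i)) ≡⟨ length-removeAt′ ys i ⟨
    length ys                    ∎
    where
    open ≤-Reasoning
    x∈ys = xs⊆ys (here ≈-refl)
    i = Any.index x∈ys
    xs⊆ys∖x : xs ⊆ₛ removeAt ys i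
    xs⊆ys∖x z∈xs = ∈-removeAt⁺ x∈ys (xs⊆ys (there z∈xs))
      (All.lookupₛ S (λ y≈z x≉y x≈z → x≉y (≈-trans x≈z (≈-sym y≈z))) x≉xs z∈xs)

module _ {a} {A : Set a} where

  ∈⇒∈-removeAt⊎≡lookup : ∀ {y} (xs : List A) (i : Fin (length xs)) → y ∈ xs →
                         y ∈ removeAt xs i ⊎ y ≡ lookup xs i
  ∈⇒∈-removeAt⊎≡lookup (x ∷ xs) zero (here y≡x) = inj₂ y≡x
  ∈⇒∈-removeAt⊎≡lookup (x ∷ xs) zero (there y∈xs) = inj₁ y∈xs
  ∈⇒∈-removeAt⊎≡lookup (x ∷ xs) (suc i) (here y≡x) = inj₁ (here y≡x)
  ∈⇒∈-removeAt⊎≡lookup (x ∷ xs) (suc i) (there y∈xs) with ∈⇒∈-removeAt⊎≡lookup xs i y∈xs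
  ... | inj₁ y∈xs∖i = inj₁ (there y∈xs∖i)
  ... | inj₂ y≡xᵢ = inj₂ y≡xᵢ

  ∈-removeAt⁻ : ∀ {y} {xs : List A} → Unique xs → (i : Fin (length xs)) → y ∈ removeAt xs i →
                y ∈ xs × y ≢ lookup xs i
  ∈-removeAt⁻ (x≢xs ∷ _) zero y∈xs = there y∈xs , λ y≡x → All.lookup x≢xs y∈xs (sym y≡x)
  ∈-removeAt⁻ {xs = x ∷ xs} (x≢xs ∷ _) (suc i) (here refl) = here refl , All.lookup x≢xs (∈-lookup i)
  ∈-removeAt⁻ (_ ∷ !xs) (suc i) (there y∈xs∖i) =
    let y∈xs , y≢xᵢ = ∈-removeAt⁻ !xs i y∈xs∖i in there y∈xs , y≢xᵢ

-- Walks, paths and reachability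

Arc : Set
Arc = Var × Var

_≟A_ : DecidableEquality Arc
_≟A_ = ≡-dec ℕ._≟_ ℕ._≟_

module _ {G : Digraph} where

  walkArcs : ∀ {a b p} → Walk G a b p → List Arc
  walkArcs here = []
  walkArcs (step {a} {b} _ w) = (a , b) ∷ walkArcs w

  walkArcs⊆E : ∀ {a b p} (w : Walk G a b p) {e} → e ∈ walkArcs w → e ∈ E G
  walkArcs⊆E (step e∈E _) (here refl) = e∈E
  walkArcs⊆E (step _ w) (there e∈w) = walkArcs⊆E w e∈w

  start∈ : ∀ {a b p} → Walk G a b p → a ∈ p
  start∈ here = here refl
  start∈ (step _ _) = here refl

  end∈ : ∀ {a b p} → Walk G a b p → b ∈ p
  end∈ here = here refl
  end∈ (step _ w) = there (end∈ w)

  walkArcs⊆vertices : ∀ {a b p} (w : Walk G a b p) {x y} → (x , y) ∈ walkArcs w → x ∈ p × y ∈ p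
  walkArcs⊆vertices (step _ w) (here refl) = here refl , there (start∈ w)
  walkArcs⊆vertices (step _ w) (there xy∈w) =
    let x∈p , y∈p = walkArcs⊆vertices w xy∈w in there x∈p , there y∈p

  endpoint∈ : ∀ {a b p v} (w : Walk G a b p) {x y} → (x , y) ∈ walkArcs w → x ≡ v ⊎ y ≡ v → v ∈ p
  endpoint∈ w xy∈w (inj₁ refl) = proj₁ (walkArcs⊆vertices w xy∈w)
  endpoint∈ w xy∈w (inj₂ refl) = proj₂ (walkArcs⊆vertices w xy∈w)

  walk-++ : ∀ {a b c p q} → Walk G a b p → Walk G b c q → ∃[ r ] Walk G a c r
  walk-++ here w′ = _ , w′
  walk-++ (step e w) w′ = _ , step e (proj₂ (walk-++ w w′))

  suffix-path : ∀ {a b c q} → Walk G b c q → Unique q → a ∈ q → ∃[ q′ ] IsPath G a c q′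
  suffix-path here !q (here refl) = _ , here , !q
  suffix-path (step e w) !q (here refl) = _ , step e w , !q
  suffix-path here _ (there ())
  suffix-path (step _ w) (_ ∷ !q) (there a∈q) = suffix-path w !q a∈q

  walk⇒path : ∀ {a b p} → Walk G a b p → ∃[ q ] IsPath G a b q
  walk⇒path here = _ , here , [] ∷ []
  walk⇒path (step {a} e w) with walk⇒path w
  ... | q , w′ , !q with a ∈? q
  ...   | yes a∈q = suffix-path w′ !q a∈q
  ...   | no a∉q = a ∷ q , step e w′ , Allₚ.¬Any⇒All¬ q a∉q ∷ !q

  target≢start : ∀ {a b p} (w : Walk G a b p) → Unique p → ∀ {x y} → (x , y) ∈ walkArcs w → y ≢ a
  target≢start (step _ w) (a∉p ∷ _) (here refl) y≡a = All.lookup a∉p (start∈ w) (sym y≡a)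
  target≢start (step _ w) (a∉p ∷ _) (there xy∈w) y≡a =
    All.lookup a∉p (proj₂ (walkArcs⊆vertices w xy∈w)) (sym y≡a)

  source≢end : ∀ {a b p} (w : Walk G a b p) → Unique p → ∀ {x y} → (x , y) ∈ walkArcs w → x ≢ b
  source≢end (step _ w) (a∉p ∷ _) (here refl) = All.lookup a∉p (end∈ w)
  source≢end (step _ w) (_ ∷ !p) (there xy∈w) = source≢end w !p xy∈w

  predecessor-unique : ∀ {a b p} (w : Walk G a b p) → Unique p → ∀ {x x′ v} →
                       (x , v) ∈ walkArcs w → (x′ , v) ∈ walkArcs w → x ≡ x′
  predecessor-unique (step _ w) _ (here refl) (here refl) = refl
  predecessor-unique (step _ w) (_ ∷ !p) (here refl) (there xv∈w) = ⊥-elim (target≢start w !p xv∈w refl)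
  predecessor-unique (step _ w) (_ ∷ !p) (there xv∈w) (here refl) = ⊥-elim (target≢start w !p xv∈w refl)
  predecessor-unique (step _ w) (_ ∷ !p) (there xv∈w) (there x′v∈w) = predecessor-unique w !p xv∈w x′v∈w

  successor-unique : ∀ {a b p} (w : Walk G a b p) → Unique p → ∀ {v y y′} →
                     (v , y) ∈ walkArcs w → (v , y′) ∈ walkArcs w → y ≡ y′
  successor-unique (step _ w) _ (here refl) (here refl) = refl
  successor-unique (step _ w) (a∉p ∷ _) (here refl) (there ay∈w) =
    ⊥-elim (All.lookup a∉p (proj₁ (walkArcs⊆vertices w ay∈w)) refl)
  successor-unique (step _ w) (a∉p ∷ _) (there ay∈w) (here refl) =
    ⊥-elim (All.lookup a∉p (proj₁ (walkArcs⊆vertices w ay∈w)) refl)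
  successor-unique (step _ w) (_ ∷ !p) (there vy∈w) (there vy′∈w) = successor-unique w !p vy∈w vy′∈w

  predecessor-exists : ∀ {a b p} (w : Walk G a b p) → ∀ {v} → v ∈ p → v ≢ a → ∃[ x ] (x , v) ∈ walkArcs w
  predecessor-exists here (here refl) v≢a = ⊥-elim (v≢a refl)
  predecessor-exists (step _ _) (here refl) v≢a = ⊥-elim (v≢a refl)
  predecessor-exists (step {a} {b} _ w) {v} (there v∈p) _ with v ℕ.≟ b
  ... | yes refl = a , here refl
  ... | no v≢b = let x , xv∈w = predecessor-exists w v∈p v≢b in x , there xv∈w

  successor-exists : ∀ {a b p} (w : Walk G a b p) → ∀ {v} → v ∈ p → v ≢ b → ∃[ y ] (v , y) ∈ walkArcs w
  successor-exists here (here refl) v≢b = ⊥-elim (v≢b refl)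
  successor-exists (step {b = b} _ _) (here refl) _ = b , here refl
  successor-exists (step _ w) (there v∈p) v≢b = let y , vy∈w = successor-exists w v∈p v≢b in y , there vy∈w

  prefix-cut : ∀ {a b p} (w : Walk G a b p) → Unique p → ∀ {e₀} → e₀ ∈ walkArcs w →
    ∃[ r ] a ∈ r × b ∉ r × (∀ {v} → v ∈ r → v ∈ p) ×
           (∀ {x y} → (x , y) ∈ walkArcs w → (x , y) ≢ e₀ → x ∈ r → y ∈ r)
  prefix-cut (step {a} a→b w) (a∉p ∷ _) (here refl) = a ∷ [] , here refl , c∉r , r⊆p , closed
    where
    c∉r : _ ∉ a ∷ []
    c∉r (here c≡a) = All.lookup a∉p (end∈ w) (sym c≡a)
    r⊆p : ∀ {v} → v ∈ a ∷ [] → v ∈ a ∷ _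
    r⊆p (here refl) = here refl
    closed : ∀ {x y} → (x , y) ∈ walkArcs (step a→b w) → (x , y) ≢ (a , _) → x ∈ a ∷ [] → y ∈ a ∷ []
    closed (here refl) ≢e₀ _ = ⊥-elim (≢e₀ refl)
    closed (there xy∈w) _ (here refl) = ⊥-elim (All.lookup a∉p (proj₁ (walkArcs⊆vertices w xy∈w)) refl)
  prefix-cut (step {a} a→b w) (a∉p ∷ !p) (there e₀∈w) with prefix-cut w !p e₀∈w
  ... | r , b∈r , c∉r , r⊆p , closed = a ∷ r , here refl , c∉a∷r , a∷r⊆p , closed′
    where
    c∉a∷r : _ ∉ a ∷ r
    c∉a∷r (here c≡a) = All.lookup a∉p (end∈ w) (sym c≡a)
    c∉a∷r (there c∈r) = c∉r c∈r
    a∷r⊆p : ∀ {v} → v ∈ a ∷ r → v ∈ a ∷ _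
    a∷r⊆p (here refl) = here refl
    a∷r⊆p (there v∈r) = there (r⊆p v∈r)
    closed′ : ∀ {x y} → (x , y) ∈ walkArcs (step a→b w) → (x , y) ≢ _ → x ∈ a ∷ r → y ∈ a ∷ r
    closed′ (here refl) _ _ = there b∈r
    closed′ (there xy∈w) _ (here refl) = ⊥-elim (All.lookup a∉p (proj₁ (walkArcs⊆vertices w xy∈w)) refl)
    closed′ (there xy∈w) ≢e₀ (there x∈r) = there (closed xy∈w ≢e₀ x∈r)

  cut-cycle : ∀ {a b p q} (w : Walk G a b p) → Unique p → (w′ : Walk G b a q) → Unique q →
    (∀ v → v ∈ p → v ∈ q → v ≡ a ⊎ v ≡ b) → ∀ {e₀} → e₀ ∈ walkArcs w →
    ∃[ r ] a ∈ r × b ∉ r ×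
           (∀ {x y} → (x , y) ∈ walkArcs w ⊎ (x , y) ∈ walkArcs w′ → (x , y) ≢ e₀ → x ∈ r → y ∈ r)
  cut-cycle w !p w′ !q disjoint e₀∈w with prefix-cut w !p e₀∈w
  ... | r , a∈r , b∉r , r⊆p , closed = r , a∈r , b∉r , closed′
    where
    closed′ : ∀ {x y} → (x , y) ∈ walkArcs w ⊎ (x , y) ∈ walkArcs w′ → (x , y) ≢ _ → x ∈ r → y ∈ r
    closed′ (inj₁ xy∈w) ≢e₀ x∈r = closed xy∈w ≢e₀ x∈r
    closed′ (inj₂ xy∈w′) _ x∈r with disjoint _ (r⊆p x∈r) (proj₁ (walkArcs⊆vertices w′ xy∈w′))
    ... | inj₁ refl = ⊥-elim (source≢end w′ !q xy∈w′ refl)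
    ... | inj₂ refl = ⊥-elim (b∉r x∈r)

module _ {G G′ : Digraph} (E⊆E′ : ∀ {e} → e ∈ E G → e ∈ E G′) where

  walk-⊆ : ∀ {a b p} → Walk G a b p → Walk G′ a b p
  walk-⊆ here = here
  walk-⊆ (step e∈E w) = step (E⊆E′ e∈E) (walk-⊆ w)

  walkArcs-walk-⊆ : ∀ {a b p} (w : Walk G a b p) → walkArcs (walk-⊆ w) ≡ walkArcs w
  walkArcs-walk-⊆ here = refl
  walkArcs-walk-⊆ (step _ w) = cong (_ ∷_) (walkArcs-walk-⊆ w)

Closed : (Var → Bool) → List Arc → Set
Closed R Es = ∀ {a b} → (a , b) ∈ Es → T (R a) → T (R b)

-- Induction on the arcs: a new arc (a , b) adds the vertices reachable from b once a is reachable.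
reachable-closure : ∀ (G : Digraph) (Es : List Arc) → (∀ {e} → e ∈ Es → e ∈ E G) → ∀ r →
  Σ[ R ∈ (Var → Bool) ] T (R r) × Closed R Es × (∀ {v} → T (R v) → ∃[ p ] Walk G r v p)
reachable-closure G [] _ r = (λ v → ⌊ v ℕ.≟ r ⌋) , fromWitness refl , (λ ()) , walk
  where
  walk : ∀ {v} → T ⌊ v ℕ.≟ r ⌋ → ∃[ p ] Walk G r v p
  walk v≡r with toWitness v≡r
  ... | refl = _ , here
reachable-closure G ((a , b) ∷ Es) Es⊆E r
  with reachable-closure G Es (λ e∈Es → Es⊆E (there e∈Es)) r
     | reachable-closure G Es (λ e∈Es → Es⊆E (there e∈Es)) b
... | R₁ , R₁r , closed₁ , walk₁ | R₂ , R₂b , closed₂ , walk₂ =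
      R , from (T-∨ {R₁ r}) (inj₁ R₁r) , closed , walk
  where
  R : Var → Bool
  R v = R₁ v ∨ (R₁ a ∧ R₂ v)
  R₁a⇒R : ∀ {v} → T (R₁ a) → T (R₂ v) → T (R v)
  R₁a⇒R {v} R₁a R₂v = from (T-∨ {R₁ v}) (inj₂ (from (T-∧ {R₁ a}) (R₁a , R₂v)))
  closed : Closed R ((a , b) ∷ Es)
  closed (here refl) Ra with to (T-∨ {R₁ a}) Ra
  ... | inj₁ R₁a = R₁a⇒R R₁a R₂b
  ... | inj₂ R₁a∧R₂a = R₁a⇒R (proj₁ (to (T-∧ {R₁ a}) R₁a∧R₂a)) R₂b
  closed {x} {y} (there xy∈Es) Rx with to (T-∨ {R₁ x}) Rx
  ... | inj₁ R₁x = from (T-∨ {R₁ y}) (inj₁ (closed₁ xy∈Es R₁x))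
  ... | inj₂ R₁a∧R₂x =
        let R₁a , R₂x = to (T-∧ {R₁ a}) R₁a∧R₂x in R₁a⇒R R₁a (closed₂ xy∈Es R₂x)
  walk : ∀ {v} → T (R v) → ∃[ p ] Walk G r v p
  walk {v} Rv with to (T-∨ {R₁ v}) Rv
  ... | inj₁ R₁v = walk₁ R₁v
  ... | inj₂ R₁a∧R₂v =
        let R₁a , R₂v = to (T-∧ {R₁ a}) R₁a∧R₂v
        in walk-++ (proj₂ (walk₁ R₁a)) (step (Es⊆E (here refl)) (proj₂ (walk₂ R₂v)))

hasIn? : ∀ (G : Digraph) v → Dec (HasIn G v)
hasIn? G v with any? (λ e → proj₂ e ℕ.≟ v) (E G)
... | yes ∃e = let (a , b) , ab∈E , b≡v = find ∃e in yes (a , subst (λ b → (a , b) ∈ E G) b≡v ab∈E)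
... | no ∄e = no λ (a , av∈E) → ∄e (lose av∈E refl)

hasOut? : ∀ (G : Digraph) v → Dec (HasOut G v)
hasOut? G v with any? (λ e → proj₁ e ℕ.≟ v) (E G)
... | yes ∃e = let (a , b) , ab∈E , a≡v = find ∃e in yes (b , subst (λ a → (a , b) ∈ E G) a≡v ab∈E)
... | no ∄e = no λ (b , vb∈E) → ∄e (lose vb∈E refl)

separated : ∀ {R : Var → Bool} {u w} → T (R u) → ¬ T (R w) → R u ≢ R w
separated Ru ¬Rw Ru≡Rw = ¬Rw (subst T Ru≡Rw Ru)

ClauseSetoid : Setoid 0ℓ 0ℓ
ClauseSetoid = record
  { Carrier = Clause
  ; _≈_ = _≈C_
  ; isEquivalence = record
    { refl = ⊆-refl , ⊆-refl
    ; sym = λ (C⊆D , D⊆C) → D⊆C , C⊆D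
    ; trans = λ (C⊆D , D⊆C) (D⊆E , E⊆D) → ⊆-trans C⊆D D⊆E , ⊆-trans E⊆D D⊆C
    }
  }

open Setoid ClauseSetoid using () renaming (refl to ≈C-refl; sym to ≈C-sym; trans to ≈C-trans)
open SetoidMembership ClauseSetoid using () renaming (_∈_ to _∈ₛ_)
open SetoidSubset ClauseSetoid using () renaming (_⊆_ to _⊆ₛ_)
open SetoidUnique ClauseSetoid using () renaming (Unique to UniqueClauses)

_≈C?_ : ∀ C D → Dec (C ≈C D)
C ≈C? D = DecSubset._⊆?_ _≟L_ C D ×-dec DecSubset._⊆?_ _≟L_ D C

_∈ₛ?_ : ∀ C F → Dec (C ∈ₛ F)
C ∈ₛ? F = any? (C ≈C?_) F

∈⇒∈ₛ : ∀ {C F} → C ∈ F → C ∈ₛ F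
∈⇒∈ₛ = Any.map λ { refl → ≈C-refl }

∈ₛ-resp-≈C : ∀ {C D F} → C ≈C D → C ∈ₛ F → D ∈ₛ F
∈ₛ-resp-≈C = SetoidMembershipₚ.∈-resp-≈ ClauseSetoid

∈ₛ-map⁺ : ∀ {A : Set} {f : A → Clause} {x xs C} → x ∈ xs → C ≈C f x → C ∈ₛ map f xs
∈ₛ-map⁺ x∈xs C≈fx = Anyₚ.map⁺ (lose x∈xs C≈fx)

∈ₛ-map⁻ : ∀ {A : Set} {f : A → Clause} {xs C} → C ∈ₛ map f xs → ∃[ x ] x ∈ xs × C ≈C f x
∈ₛ-map⁻ C∈ = find (Anyₚ.map⁻ C∈)

⊆CS⇒⊆ₛ : ∀ {F F′} → F ⊆CS F′ → F ⊆ₛ F′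
⊆CS⇒⊆ₛ = All.lookupₛ ClauseSetoid ∈ₛ-resp-≈C

SatClause-⊆ : ∀ {φ C D} → SatClause φ C → C ⊆ D → SatClause φ D
SatClause-⊆ φ⊨C C⊆D = Any-resp-⊆ C⊆D φ⊨C

satisfiable-⊆ₛ : ∀ {F F′} → F ⊆ₛ F′ → Satisfiable F′ → Satisfiable F
satisfiable-⊆ₛ F⊆F′ (φ , φ⊨F′) = φ , All.tabulate λ C∈F →
  let D , D∈F′ , C≈D = find (F⊆F′ (∈⇒∈ₛ C∈F)) in SatClause-⊆ (All.lookup φ⊨F′ D∈F′) (proj₂ C≈D)

unsatisfiable-subset-of-MU : ∀ {F Ds} → (∀ i → Satisfiable (removeAt F i)) →
                             Ds ⊆ₛ F → ¬ Satisfiable Ds → F ⊆ₛ Ds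
unsatisfiable-subset-of-MU {F} {Ds} removable Ds⊆F unsat C∈F
  with find C∈F
... | D , D∈F , C≈D with D ∈ₛ? Ds
...   | yes D∈Ds = ∈ₛ-resp-≈C (≈C-sym C≈D) D∈Ds
...   | no D∉Ds = ⊥-elim (unsat (satisfiable-⊆ₛ Ds⊆F∖D (removable i)))
  where
  i = Any.index D∈F
  Ds⊆F∖D : Ds ⊆ₛ removeAt F i
  Ds⊆F∖D X∈Ds with find (Ds⊆F X∈Ds)
  ... | Y , Y∈F , X≈Y with ∈⇒∈-removeAt⊎≡lookup F i Y∈F
  ...   | inj₁ Y∈F∖D = Any.map (λ { refl → X≈Y }) Y∈F∖D
  ...   | inj₂ Y≡D =
          ⊥-elim (D∉Ds (∈ₛ-resp-≈C (subst (_ ≈C_) (trans Y≡D (sym (Anyₚ.lookup-index D∈F))) X≈Y) X∈Ds))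

ldeg-≤ : ∀ {F Ds l} → UniqueClauses F → (∀ {C} → C ∈ F → l ∈ C → C ∈ₛ Ds) → ldeg F l ≤ length Ds
ldeg-≤ {F} {Ds} {l} !F F⊆Ds =
  Unique⇒length-≤ ClauseSetoid (SetoidUniqueₚ.filter⁺ ClauseSetoid (l ∈L?_) !F) sub
  where
  sub : filter (l ∈L?_) F ⊆ₛ Ds
  sub C∈ with find C∈
  ... | D , D∈ , C≈D =
        let D∈F , l∈D = ∈-filter⁻ (l ∈L?_) D∈ in ∈ₛ-resp-≈C (≈C-sym C≈D) (F⊆Ds D∈F l∈D)

≤-ldeg : ∀ {F Ds l} → UniqueClauses Ds → (∀ {D} → D ∈ Ds → l ∈ D × D ∈ₛ F) → length Ds ≤ ldeg F l
≤-ldeg {F} {Ds} {l} !Ds Ds⊆F = Unique⇒length-≤ ClauseSetoid !Ds sub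
  where
  sub : Ds ⊆ₛ filter (l ∈L?_) F
  sub X∈ with find X∈
  ... | D , D∈Ds , X≈D with Ds⊆F D∈Ds
  ...   | l∈D , D∈ₛF with find D∈ₛF
  ...     | C , C∈F , D≈C = lose (∈-filter⁺ (l ∈L?_) C∈F (proj₁ D≈C l∈D)) (≈C-trans X≈D D≈C)

∈-vars⁺ : ∀ {F C l} → C ∈ₛ F → l ∈ C → var l ∈ vars F
∈-vars⁺ C∈F l∈C with find C∈F
... | D , D∈F , C≈D =
      ∈-deduplicate⁺ ℕ._≟_ (∈-concatMap⁺ (map var) (lose D∈F (∈-map⁺ var (proj₁ C≈D l∈C))))

∈-vars⁻ : ∀ {F v} → v ∈ vars F → ∃[ C ] C ∈ F × ∃[ l ] l ∈ C × v ≡ var l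
∈-vars⁻ {F} v∈ with find (∈-concatMap⁻ (map var) (∈-deduplicate⁻ ℕ._≟_ (concatMap (map var) F) v∈))
... | C , C∈F , v∈C = C , C∈F , ∈-map⁻ var v∈C

2≤deficiency : ∀ {F} → 2 + nVars F ≤ cClauses F → + 2 ≤ℤ deficiency F
2≤deficiency {F} 2+n≤c = subst (+ 2 ≤ℤ_) (sym c-n≡c∸n) (+≤+ (m+n≤o⇒m≤o∸n 2 2+n≤c))
  where
  c-n≡c∸n : deficiency F ≡ + (cClauses F ℕ.∸ nVars F)
  c-n≡c∸n = trans ([+m]-[+n]≡m⊖n (cClauses F) (nVars F)) (⊖-≥ (m+n≤o⇒n≤o 2 2+n≤c))

nDeg-≤ : ∀ {F k ys} → (∀ {v} → v ∈ vars F → vdeg F v ≡ k → v ∈ ys) → nDeg k F ≤ length ys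
nDeg-≤ {F} {k} vars→ys = Unique⇒length-≤ (≡.setoid Var)
  (Uniqueₚ.filter⁺ (λ v → vdeg F v ℕ.≟ k) (deduplicate-! ℕ._≟_ (concatMap (map var) F)))
  (λ v∈ → let v∈vars , deg≡k = ∈-filter⁻ (λ v → vdeg F v ℕ.≟ k) v∈ in vars→ys v∈vars deg≡k)

≤-nDeg : ∀ {F k ys} → Unique ys → (∀ {v} → v ∈ ys → v ∈ vars F × vdeg F v ≡ k) → length ys ≤ nDeg k F
≤-nDeg {F} {k} !ys ys→vars = Unique⇒length-≤ (≡.setoid Var) !ys
  (λ v∈ys → let v∈vars , deg≡k = ys→vars v∈ys in ∈-filter⁺ (λ v → vdeg F v ℕ.≟ k) v∈vars deg≡k)

between-1-and-2 : ∀ {n} → 1 ≤ n → n ≤ 2 → n ≡ 1 ⊎ n ≡ 2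
between-1-and-2 (s≤s z≤n) (s≤s z≤n) = inj₁ refl
between-1-and-2 (s≤s z≤n) (s≤s (s≤s z≤n)) = inj₂ refl

compl-involutive : ∀ l → compl (compl l) ≡ l
compl-involutive (b , v) = cong (_, v) (not-involutive b)

compl-≢ : ∀ l → compl l ≢ l
compl-≢ (true , v) ()
compl-≢ (false , v) ()

flip-compl : ∀ {l l′} → l ≡ compl l′ → compl l ≡ l′
flip-compl {l′ = l′} refl = compl-involutive l′

litVal-compl : ∀ φ l → litVal φ (compl l) ≡ not (litVal φ l)
litVal-compl φ (true , v) = refl
litVal-compl φ (false , v) = sym (not-involutive (φ v))

-- The translation tFC

module Translation (s t x₀ : Var) (s≢t : s ≢ t) (s≢x₀ : s ≢ x₀) (t≢x₀ : t ≢ x₀) where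

  lit : Var → Lit
  lit = τ s t x₀

  clause : Arc → Clause
  clause = τArc s t x₀

  Terminal : Var → Set
  Terminal v = v ≡ s ⊎ v ≡ t

  terminal? : ∀ v → Dec (Terminal v)
  terminal? v = v ℕ.≟ s ⊎-dec v ℕ.≟ t

  lit-s : lit s ≡ pos x₀
  lit-s with s ℕ.≟ s
  ... | yes _ = refl
  ... | no s≢s = ⊥-elim (s≢s refl)

  lit-t : lit t ≡ neg x₀
  lit-t with t ℕ.≟ s | t ℕ.≟ t
  ... | yes t≡s | _ = ⊥-elim (s≢t (sym t≡s))
  ... | no _ | yes _ = refl
  ... | no _ | no t≢t = ⊥-elim (t≢t refl)

  lit-inner : ∀ {v} → ¬ Terminal v → lit v ≡ pos v
  lit-inner {v} ¬terminal with v ℕ.≟ s | v ℕ.≟ t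
  ... | yes v≡s | _ = ⊥-elim (¬terminal (inj₁ v≡s))
  ... | no _ | yes v≡t = ⊥-elim (¬terminal (inj₂ v≡t))
  ... | no _ | no _ = refl

  data LitView (v : Var) : Set where
    at-s : v ≡ s → LitView v
    at-t : v ≡ t → LitView v
    at-inner : ¬ Terminal v → LitView v

  litView : ∀ v → LitView v
  litView v with v ℕ.≟ s | v ℕ.≟ t
  ... | yes v≡s | _ = at-s v≡s
  ... | no _ | yes v≡t = at-t v≡t
  ... | no v≢s | no v≢t = at-inner λ { (inj₁ v≡s) → v≢s v≡s ; (inj₂ v≡t) → v≢t v≡t }

  var-lit-terminal : ∀ {v} → Terminal v → var (lit v) ≡ x₀
  var-lit-terminal (inj₁ refl) = cong var lit-s
  var-lit-terminal (inj₂ refl) = cong var lit-t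

  var-lit-inner : ∀ {v} → ¬ Terminal v → var (lit v) ≡ v
  var-lit-inner ¬terminal = cong var (lit-inner ¬terminal)

  lit≡pos : ∀ {v y} → lit v ≡ pos y → v ≡ s × y ≡ x₀ ⊎ v ≡ y
  lit≡pos {v} eq with litView v
  ... | at-s refl = inj₁ (refl , sym (cong var (trans (sym lit-s) eq)))
  ... | at-t refl with trans (sym lit-t) eq
  ...   | ()
  lit≡pos {v} eq | at-inner ¬terminal = inj₂ (cong var (trans (sym (lit-inner ¬terminal)) eq))

  lit≡neg : ∀ {v y} → lit v ≡ neg y → v ≡ t × y ≡ x₀
  lit≡neg {v} eq with litView v
  ... | at-s refl with trans (sym lit-s) eq
  ...   | ()
  lit≡neg {v} eq | at-t refl = refl , sym (cong var (trans (sym lit-t) eq))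
  lit≡neg {v} eq | at-inner ¬terminal with trans (sym (lit-inner ¬terminal)) eq
  ...   | ()

  lit-injective : ∀ {u w} → u ≢ x₀ → w ≢ x₀ → lit u ≡ lit w → u ≡ w
  lit-injective {u} {w} u≢x₀ w≢x₀ eq with litView u
  ... | at-s refl with lit≡pos (trans (sym eq) lit-s)
  ...   | inj₁ (w≡s , _) = sym w≡s
  ...   | inj₂ w≡x₀ = ⊥-elim (w≢x₀ w≡x₀)
  lit-injective u≢x₀ w≢x₀ eq | at-t refl = sym (proj₁ (lit≡neg (trans (sym eq) lit-t)))
  lit-injective u≢x₀ w≢x₀ eq | at-inner ¬terminal with lit≡pos (trans (sym eq) (lit-inner ¬terminal))
  ...   | inj₁ (_ , u≡x₀) = ⊥-elim (u≢x₀ u≡x₀)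
  ...   | inj₂ w≡u = sym w≡u

  compl-lit≡lit : ∀ {u w} → u ≢ x₀ → w ≢ x₀ → compl (lit u) ≡ lit w → Terminal u × Terminal w
  compl-lit≡lit {u} u≢x₀ w≢x₀ eq with litView u
  ... | at-s refl = inj₁ refl , inj₂ (proj₁ (lit≡neg (trans (sym eq) (cong compl lit-s))))
  ... | at-t refl with lit≡pos (trans (sym eq) (cong compl lit-t))
  ...   | inj₁ (w≡s , _) = inj₂ refl , inj₁ w≡s
  ...   | inj₂ w≡x₀ = ⊥-elim (w≢x₀ w≡x₀)
  compl-lit≡lit u≢x₀ w≢x₀ eq | at-inner ¬terminal =
    ⊥-elim (u≢x₀ (proj₂ (lit≡neg (trans (sym eq) (cong compl (lit-inner ¬terminal))))))

  ∈-clause⁻ : ∀ a b {l} → l ∈ clause (a , b) → l ≡ compl (lit a) ⊎ l ≡ lit b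
  ∈-clause⁻ _ _ (here l≡) = inj₁ l≡
  ∈-clause⁻ _ _ (there (here l≡)) = inj₂ l≡

  pos-x₀∈clause⁻ : ∀ {a b} → b ≢ x₀ → pos x₀ ∈ clause (a , b) → b ≡ s ⊎ a ≡ t
  pos-x₀∈clause⁻ {a = a} {b} b≢x₀ l∈ with ∈-clause⁻ a b l∈
  ... | inj₁ eq = inj₂ (proj₁ (lit≡neg (sym (flip-compl eq))))
  ... | inj₂ eq with lit≡pos (sym eq)
  ...   | inj₁ (b≡s , _) = inj₁ b≡s
  ...   | inj₂ b≡x₀ = ⊥-elim (b≢x₀ b≡x₀)

  pos-x₀∈clause⁺ : ∀ {a b} → b ≡ s ⊎ a ≡ t → pos x₀ ∈ clause (a , b)
  pos-x₀∈clause⁺ (inj₁ refl) = there (here (sym lit-s))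
  pos-x₀∈clause⁺ (inj₂ refl) = here (cong compl (sym lit-t))

  neg-x₀∈clause⁻ : ∀ {a b} → a ≢ x₀ → neg x₀ ∈ clause (a , b) → a ≡ s ⊎ b ≡ t
  neg-x₀∈clause⁻ {a = a} {b} a≢x₀ l∈ with ∈-clause⁻ a b l∈
  ... | inj₂ eq = inj₂ (proj₁ (lit≡neg (sym eq)))
  ... | inj₁ eq with lit≡pos (sym (flip-compl eq))
  ...   | inj₁ (a≡s , _) = inj₁ a≡s
  ...   | inj₂ a≡x₀ = ⊥-elim (a≢x₀ a≡x₀)

  neg-x₀∈clause⁺ : ∀ {a b} → a ≡ s ⊎ b ≡ t → neg x₀ ∈ clause (a , b)
  neg-x₀∈clause⁺ (inj₁ refl) = here (cong compl (sym lit-s))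
  neg-x₀∈clause⁺ (inj₂ refl) = there (here (sym lit-t))

  pos∈clause⁻ : ∀ {v a b} → v ≢ x₀ → pos v ∈ clause (a , b) → b ≡ v
  pos∈clause⁻ {a = a} {b} v≢x₀ l∈ with ∈-clause⁻ a b l∈
  ... | inj₁ eq = ⊥-elim (v≢x₀ (proj₂ (lit≡neg {a} (sym (flip-compl eq)))))
  ... | inj₂ eq with lit≡pos (sym eq)
  ...   | inj₁ (_ , v≡x₀) = ⊥-elim (v≢x₀ v≡x₀)
  ...   | inj₂ b≡v = b≡v

  pos∈clause⁺ : ∀ {v a} → ¬ Terminal v → pos v ∈ clause (a , v)
  pos∈clause⁺ ¬terminal = there (here (sym (lit-inner ¬terminal)))

  neg∈clause⁻ : ∀ {v a b} → v ≢ x₀ → neg v ∈ clause (a , b) → a ≡ v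
  neg∈clause⁻ {a = a} {b} v≢x₀ l∈ with ∈-clause⁻ a b l∈
  ... | inj₂ eq = ⊥-elim (v≢x₀ (proj₂ (lit≡neg {b} (sym eq))))
  ... | inj₁ eq with lit≡pos (sym (flip-compl eq))
  ...   | inj₁ (_ , v≡x₀) = ⊥-elim (v≢x₀ v≡x₀)
  ...   | inj₂ a≡v = a≡v

  neg∈clause⁺ : ∀ {v b} → ¬ Terminal v → neg v ∈ clause (v , b)
  neg∈clause⁺ ¬terminal = here (cong compl (sym (lit-inner ¬terminal)))

  ProperArc : Arc → Set
  ProperArc (a , b) = a ≢ b × a ≢ x₀ × b ≢ x₀ × ¬ (Terminal a × Terminal b)

  clause-isClause : ∀ {e} → ProperArc e → IsClause (clause e)
  clause-isClause {a , b} (a≢b , a≢x₀ , b≢x₀ , ¬terminal) =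
    ((λ eq → ¬terminal (compl-lit≡lit a≢x₀ b≢x₀ eq)) ∷ []) ∷ [] ∷ [] , no-complementary-pair
    where
    no-complementary-pair : ∀ l → l ∈ clause (a , b) → compl l ∉ clause (a , b)
    no-complementary-pair l l∈ l̄∈ with ∈-clause⁻ a b l∈ | ∈-clause⁻ a b l̄∈
    ... | inj₁ refl | inj₁ eq = compl-≢ _ eq
    ... | inj₁ refl | inj₂ eq = a≢b (lit-injective a≢x₀ b≢x₀ (trans (sym (compl-involutive _)) eq))
    ... | inj₂ refl | inj₁ eq = a≢b (sym (lit-injective b≢x₀ a≢x₀ (compl-injective eq)))
      where
      compl-injective : ∀ {l l′} → compl l ≡ compl l′ → l ≡ l′
      compl-injective {l} {l′} eq = trans (sym (compl-involutive l)) (flip-compl eq)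
    ... | inj₂ refl | inj₂ eq = compl-≢ _ eq

  clause-injective : ∀ {e e′} → ProperArc e → ProperArc e′ → clause e ⊆ clause e′ → e ≡ e′
  clause-injective {a , b} {a′ , b′} (_ , a≢x₀ , b≢x₀ , ¬terminal) (_ , a′≢x₀ , b′≢x₀ , _) ⊆′
    with ∈-clause⁻ a′ b′ (⊆′ (here refl)) | ∈-clause⁻ a′ b′ (⊆′ (there (here refl)))
  ... | inj₁ eq | inj₂ eq′ =
        cong₂ _,_ (lit-injective a≢x₀ a′≢x₀ (trans (sym (compl-involutive _)) (flip-compl eq)))
                  (lit-injective b≢x₀ b′≢x₀ eq′)
  ... | inj₁ eq | inj₁ eq′ =
        let a′-terminal , b-terminal = compl-lit≡lit a′≢x₀ b≢x₀ (sym eq′)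
            a≡a′ = lit-injective a≢x₀ a′≢x₀ (trans (sym (compl-involutive _)) (flip-compl eq))
        in ⊥-elim (¬terminal (subst Terminal (sym a≡a′) a′-terminal , b-terminal))
  ... | inj₂ eq | inj₁ eq′ =
        ⊥-elim (¬terminal (proj₁ (compl-lit≡lit a≢x₀ b′≢x₀ eq) ,
                           proj₂ (compl-lit≡lit a′≢x₀ b≢x₀ (sym eq′))))
  ... | inj₂ eq | inj₂ eq′ = ⊥-elim (¬terminal (compl-lit≡lit a≢x₀ b≢x₀ (trans eq (sym eq′))))

  map-clause-unique : ∀ {es} → All ProperArc es → Unique es → UniqueClauses (map clause es)
  map-clause-unique [] [] = []
  map-clause-unique (proper ∷ propers) (e∉es ∷ !es) =
    Allₚ.map⁺ (All.zipWith
      (λ (e≢e′ , proper′) eq → e≢e′ (clause-injective proper proper′ (λ l∈ → proj₁ eq l∈)))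
      (e∉es , propers))
    ∷ map-clause-unique propers !es

  Separates : (Var → Bool) → Set
  Separates R = R s ≢ R t

  assignment : (Var → Bool) → Assignment
  assignment R v = if ⌊ v ℕ.≟ x₀ ⌋ then R s else R v

  assignment-x₀ : ∀ R → assignment R x₀ ≡ R s
  assignment-x₀ R with x₀ ℕ.≟ x₀
  ... | yes _ = refl
  ... | no x₀≢x₀ = ⊥-elim (x₀≢x₀ refl)

  litVal-assignment : ∀ {R v} → Separates R → v ≢ x₀ → litVal (assignment R) (lit v) ≡ R v
  litVal-assignment {R} {v} separates v≢x₀ with litView v
  ... | at-s refl rewrite lit-s = assignment-x₀ R
  ... | at-t refl rewrite lit-t = trans (cong not (assignment-x₀ R)) (sym (¬-not (≢-sym separates)))
  ... | at-inner ¬terminal rewrite lit-inner ¬terminal with v ℕ.≟ x₀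
  ...   | yes v≡x₀ = ⊥-elim (v≢x₀ v≡x₀)
  ...   | no _ = refl

  InternallyDisjoint : List Var → List Var → Set
  InternallyDisjoint p q = ∀ v → v ∈ p → v ∈ q → Terminal v

  X₀Free : List Arc → Set
  X₀Free Es = ∀ {a b} → (a , b) ∈ Es → a ≢ x₀ × b ≢ x₀

  implication⇒clause-sat : ∀ {φ a b} → (litVal φ (lit a) ≡ true → litVal φ (lit b) ≡ true) →
                           SatClause φ (clause (a , b))
  implication⇒clause-sat {φ} {a} a⇒b with litVal φ (lit a) in eq
  ... | true = there (here (a⇒b refl))
  ... | false = here (trans (litVal-compl φ (lit a)) (cong not eq))

  clause-sat⇒implication : ∀ {φ a b} → SatClause φ (clause (a , b)) →
                           litVal φ (lit a) ≡ true → litVal φ (lit b) ≡ true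
  clause-sat⇒implication {φ} {a} (here ā-true) a-true =
    contradiction (trans (sym ā-true) (trans (litVal-compl φ (lit a)) (cong not a-true))) λ ()
  clause-sat⇒implication (there (here b-true)) _ = b-true

  closed⇒satisfied : ∀ {Es R} → X₀Free Es → Separates R → Closed R Es →
                     All (SatClause (assignment R)) (map clause Es)
  closed⇒satisfied {Es} {R} x₀-free separates closed = Allₚ.map⁺ (All.tabulate λ { {a , b} ab∈Es →
    let a≢x₀ , b≢x₀ = x₀-free ab∈Es in
    implication⇒clause-sat {a = a} {b} λ a-true →
      trans (litVal-assignment separates b≢x₀)
            (to (T-≡ {R b}) (closed ab∈Es
              (from (T-≡ {R a}) (trans (sym (litVal-assignment separates a≢x₀)) a-true)))) })

  walk-propagates : ∀ {G φ a b p} (w : Walk G a b p) → (∀ {e} → e ∈ walkArcs w → SatClause φ (clause e)) →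
                    litVal φ (lit a) ≡ true → litVal φ (lit b) ≡ true
  walk-propagates here _ a-true = a-true
  walk-propagates (step {a} {b} _ w) φ⊨w a-true =
    walk-propagates w (λ e∈w → φ⊨w (there e∈w))
                      (clause-sat⇒implication {a = a} {b} (φ⊨w (here refl)) a-true)

  litVal-lit-s : ∀ φ → litVal φ (lit s) ≡ φ x₀
  litVal-lit-s φ = cong (litVal φ) lit-s

  litVal-lit-t : ∀ φ → litVal φ (lit t) ≡ not (φ x₀)
  litVal-lit-t φ = cong (litVal φ) lit-t

  closed-walk-falsifies : ∀ {G φ p₁ p₂} (w₁ : Walk G s t p₁) (w₂ : Walk G t s p₂) →
                          (∀ {e} → e ∈ walkArcs w₁ → SatClause φ (clause e)) →
                          (∀ {e} → e ∈ walkArcs w₂ → SatClause φ (clause e)) → ⊥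
  closed-walk-falsifies {φ = φ} w₁ w₂ φ⊨w₁ φ⊨w₂ with φ x₀ in x₀-value
  ... | true = contradiction
        (trans (sym (walk-propagates w₁ φ⊨w₁ (trans (litVal-lit-s φ) x₀-value)))
               (trans (litVal-lit-t φ) (cong not x₀-value)))
        λ ()
  ... | false = contradiction
        (trans (sym (walk-propagates w₂ φ⊨w₂ (trans (litVal-lit-t φ) (cong not x₀-value))))
               (trans (litVal-lit-s φ) x₀-value))
        λ ()

  terminal-indicator-separates : ∀ {r} → Terminal r → Separates (λ v → ⌊ v ℕ.≟ r ⌋)
  terminal-indicator-separates (inj₁ refl) =
    separated {λ v → ⌊ v ℕ.≟ s ⌋} (fromWitness refl) (λ t≡s → s≢t (sym (toWitness t≡s)))
  terminal-indicator-separates (inj₂ refl) =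
    ≢-sym (separated {λ v → ⌊ v ℕ.≟ t ⌋} (fromWitness refl) (λ s≡t → s≢t (toWitness s≡t)))

  module _ (G : Digraph) (x₀-free : X₀Free (E G)) where

    satisfiable-if-closed : ∀ R → Separates R → Closed R (E G) → Satisfiable (tFC s t x₀ G)
    satisfiable-if-closed R separates closed = assignment R , closed⇒satisfied x₀-free separates closed

    no-out-arc⇒satisfiable : ∀ {r} → Terminal r → ¬ HasOut G r → Satisfiable (tFC s t x₀ G)
    no-out-arc⇒satisfiable {r} terminal no-out =
      satisfiable-if-closed (λ v → ⌊ v ℕ.≟ r ⌋) (terminal-indicator-separates terminal) closed
      where
      closed : Closed (λ v → ⌊ v ℕ.≟ r ⌋) (E G)
      closed {a} {b} ab∈E a≡r with toWitness a≡r
      ... | refl = ⊥-elim (no-out (b , ab∈E))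

    no-in-arc⇒satisfiable : ∀ {r} → Terminal r → ¬ HasIn G r → Satisfiable (tFC s t x₀ G)
    no-in-arc⇒satisfiable {r} terminal no-in =
      satisfiable-if-closed (λ v → isNo (v ℕ.≟ r))
                            (terminal-indicator-separates terminal ∘ not-injective) closed
      where
      closed : Closed (λ v → isNo (v ℕ.≟ r)) (E G)
      closed {a} {b} ab∈E _ = fromWitnessFalse λ { refl → no-in (a , ab∈E) }

    missing-terminal-arc⇒satisfiable : ¬ (HasIn G s × HasOut G s × HasIn G t × HasOut G t) →
                                       Satisfiable (tFC s t x₀ G)
    missing-terminal-arc⇒satisfiable all-present with hasIn? G s | hasOut? G s | hasIn? G t | hasOut? G t
    ... | no ¬in | _ | _ | _ = no-in-arc⇒satisfiable (inj₁ refl) ¬in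
    ... | yes _ | no ¬out | _ | _ = no-out-arc⇒satisfiable (inj₁ refl) ¬out
    ... | yes _ | yes _ | no ¬in | _ = no-in-arc⇒satisfiable (inj₂ refl) ¬in
    ... | yes _ | yes _ | yes _ | no ¬out = no-out-arc⇒satisfiable (inj₂ refl) ¬out
    ... | yes in-s | yes out-s | yes in-t | yes out-t = ⊥-elim (all-present (in-s , out-s , in-t , out-t))

    special-closed-walk⇒unsatisfiable : SpecialClosedWalk s t G → ¬ Satisfiable (tFC s t x₀ G)
    special-closed-walk⇒unsatisfiable (_ , _ , (w₁ , _) , (w₂ , _)) (φ , φ⊨G) =
      closed-walk-falsifies w₁ w₂ (satisfies w₁) (satisfies w₂)
      where
      satisfies : ∀ {a b p} (w : Walk G a b p) → ∀ {e} → e ∈ walkArcs w → SatClause φ (clause e)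
      satisfies w e∈w = All.lookup (Allₚ.map⁻ φ⊨G) (walkArcs⊆E w e∈w)

    unsatisfiable⇒special-closed-walk : ¬ Satisfiable (tFC s t x₀ G) → SpecialClosedWalk s t G
    unsatisfiable⇒special-closed-walk unsat =
      let p₁ , path₁ = path-between (λ {R} Rs ¬Rt → separated {R} Rs ¬Rt)
          p₂ , path₂ = path-between (λ {R} Rt ¬Rs → ≢-sym (separated {R} Rt ¬Rs))
      in p₁ , p₂ , path₁ , path₂
      where
      path-between : ∀ {r r′} → (∀ {R} → T (R r) → ¬ T (R r′) → Separates R) → ∃[ p ] IsPath G r r′ p
      path-between {r} {r′} separates with reachable-closure G (E G) (λ e∈E → e∈E) r
      ... | R , Rr , closed , walk-to with T? (R r′)
      ...   | yes Rr′ = walk⇒path (proj₂ (walk-to Rr′))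
      ...   | no ¬Rr′ = ⊥-elim (unsat (satisfiable-if-closed R (separates Rr ¬Rr′) closed))

    special-closed-walk⇔unsatisfiable : SpecialClosedWalk s t G ⇔ (¬ Satisfiable (tFC s t x₀ G))
    special-closed-walk⇔unsatisfiable =
      mk⇔ special-closed-walk⇒unsatisfiable unsatisfiable⇒special-closed-walk

  -- Minimally unsatisfiable subsets of tFC(G)

  module _ (G : Digraph) (isG : IsStDigraph s t x₀ G) where

    arc-proper : ∀ {e} → e ∈ E G → ProperArc e
    arc-proper {a , b} ab∈E = proper isG
      where
      proper : IsStDigraph s t x₀ G → ProperArc (a , b)
      proper (_ , _ , endpoints , _ , _ , x₀∉V , st∉E , ts∉E) with endpoints a b ab∈E
      ... | a≢b , a∈V , b∈V = a≢b , (λ { refl → x₀∉V a∈V }) , (λ { refl → x₀∉V b∈V }) , ¬terminal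
        where
        ¬terminal : ¬ (Terminal a × Terminal b)
        ¬terminal (inj₁ refl , inj₁ refl) = a≢b refl
        ¬terminal (inj₁ refl , inj₂ refl) = st∉E ab∈E
        ¬terminal (inj₂ refl , inj₁ refl) = ts∉E ab∈E
        ¬terminal (inj₂ refl , inj₂ refl) = a≢b refl

    x₀-free : X₀Free (E G)
    x₀-free ab∈E = let _ , a≢x₀ , b≢x₀ , _ = arc-proper ab∈E in a≢x₀ , b≢x₀

    no-terminal-arc : ∀ {a b} → (a , b) ∈ E G → Terminal a → Terminal b → ⊥
    no-terminal-arc ab∈E a-terminal b-terminal =
      proj₂ (proj₂ (proj₂ (arc-proper ab∈E))) (a-terminal , b-terminal)

    arcs-clauses-unique : ∀ {es} → (∀ {e} → e ∈ es → e ∈ E G) → Unique es → UniqueClauses (map clause es)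
    arcs-clauses-unique es⊆E = map-clause-unique (All.tabulate (arc-proper ∘ es⊆E))

    pathArcs : ∀ {p₁ p₂} → Walk G s t p₁ → Walk G t s p₂ → List Arc
    pathArcs w₁ w₂ = deduplicate _≟A_ (walkArcs w₁ ++ walkArcs w₂)

    module TwoPaths {p₁ p₂} (w₁ : Walk G s t p₁) (!p₁ : Unique p₁)
                            (w₂ : Walk G t s p₂) (!p₂ : Unique p₂) where

      H : List Arc
      H = pathArcs w₁ w₂

      ∈H⁻ : ∀ {e} → e ∈ H → e ∈ walkArcs w₁ ⊎ e ∈ walkArcs w₂
      ∈H⁻ e∈H = ∈-++⁻ (walkArcs w₁) (∈-deduplicate⁻ _≟A_ _ e∈H)

      ∈H⁺ : ∀ {e} → e ∈ walkArcs w₁ ⊎ e ∈ walkArcs w₂ → e ∈ H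
      ∈H⁺ (inj₁ e∈w₁) = ∈-deduplicate⁺ _≟A_ (∈-++⁺ˡ e∈w₁)
      ∈H⁺ (inj₂ e∈w₂) = ∈-deduplicate⁺ _≟A_ (∈-++⁺ʳ (walkArcs w₁) e∈w₂)

      H-unique : Unique H
      H-unique = deduplicate-! _≟A_ _

      H⊆E : ∀ {e} → e ∈ H → e ∈ E G
      H⊆E e∈H = [ walkArcs⊆E w₁ , walkArcs⊆E w₂ ] (∈H⁻ e∈H)

      H-endpoints : ∀ {a b} → (a , b) ∈ H → (a ∈ p₁ ⊎ a ∈ p₂) × (b ∈ p₁ ⊎ b ∈ p₂)
      H-endpoints ab∈H with ∈H⁻ ab∈H
      ... | inj₁ ab∈w₁ = Product.map inj₁ inj₁ (walkArcs⊆vertices w₁ ab∈w₁)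
      ... | inj₂ ab∈w₂ = Product.map inj₂ inj₂ (walkArcs⊆vertices w₂ ab∈w₂)

      clauses-unsatisfiable : ¬ Satisfiable (map clause H)
      clauses-unsatisfiable (φ , φ⊨H) = closed-walk-falsifies w₁ w₂ (satisfies ∘ inj₁) (satisfies ∘ inj₂)
        where
        satisfies : ∀ {e} → e ∈ walkArcs w₁ ⊎ e ∈ walkArcs w₂ → SatClause φ (clause e)
        satisfies e∈ = All.lookup (Allₚ.map⁻ φ⊨H) (∈H⁺ e∈)

      first-arc₁ : ∃[ y ] (s , y) ∈ walkArcs w₁
      first-arc₁ = successor-exists w₁ (start∈ w₁) s≢t

      last-arc₁ : ∃[ z ] (z , t) ∈ walkArcs w₁
      last-arc₁ = predecessor-exists w₁ (end∈ w₁) (≢-sym s≢t)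

      first-arc₂ : ∃[ y ] (t , y) ∈ walkArcs w₂
      first-arc₂ = successor-exists w₂ (start∈ w₂) (≢-sym s≢t)

      last-arc₂ : ∃[ z ] (z , s) ∈ walkArcs w₂
      last-arc₂ = predecessor-exists w₂ (end∈ w₂) s≢t

      H-into-s : ∀ {a z} → (z , s) ∈ walkArcs w₂ → (a , s) ∈ H → a ≡ z
      H-into-s zs∈w₂ as∈H with ∈H⁻ as∈H
      ... | inj₁ as∈w₁ = ⊥-elim (target≢start w₁ !p₁ as∈w₁ refl)
      ... | inj₂ as∈w₂ = predecessor-unique w₂ !p₂ as∈w₂ zs∈w₂

      H-out-of-t : ∀ {b y} → (t , y) ∈ walkArcs w₂ → (t , b) ∈ H → b ≡ y
      H-out-of-t ty∈w₂ tb∈H with ∈H⁻ tb∈H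
      ... | inj₁ tb∈w₁ = ⊥-elim (source≢end w₁ !p₁ tb∈w₁ refl)
      ... | inj₂ tb∈w₂ = successor-unique w₂ !p₂ tb∈w₂ ty∈w₂

      H-into-t : ∀ {a z} → (z , t) ∈ walkArcs w₁ → (a , t) ∈ H → a ≡ z
      H-into-t zt∈w₁ at∈H with ∈H⁻ at∈H
      ... | inj₁ at∈w₁ = predecessor-unique w₁ !p₁ at∈w₁ zt∈w₁
      ... | inj₂ at∈w₂ = ⊥-elim (target≢start w₂ !p₂ at∈w₂ refl)

      H-out-of-s : ∀ {b y} → (s , y) ∈ walkArcs w₁ → (s , b) ∈ H → b ≡ y
      H-out-of-s sy∈w₁ sb∈H with ∈H⁻ sb∈H
      ... | inj₁ sb∈w₁ = successor-unique w₁ !p₁ sb∈w₁ sy∈w₁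
      ... | inj₂ sb∈w₂ = ⊥-elim (source≢end w₂ !p₂ sb∈w₂ refl)

      inner : List Var
      inner = filter (¬? ∘ terminal?) (deduplicate ℕ._≟_ (p₁ ++ p₂))

      ∈inner⁻ : ∀ {v} → v ∈ inner → (v ∈ p₁ ⊎ v ∈ p₂) × ¬ Terminal v
      ∈inner⁻ v∈ = let v∈p , ¬terminal = ∈-filter⁻ (¬? ∘ terminal?) v∈ in
                   ∈-++⁻ p₁ (∈-deduplicate⁻ ℕ._≟_ _ v∈p) , ¬terminal

      ∈inner⁺ : ∀ {v} → v ∈ p₁ ⊎ v ∈ p₂ → ¬ Terminal v → v ∈ inner
      ∈inner⁺ v∈p ¬terminal = ∈-filter⁺ (¬? ∘ terminal?) (∈-deduplicate⁺ ℕ._≟_ (∈-++ v∈p)) ¬terminal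
        where
        ∈-++ : ∀ {v} → v ∈ p₁ ⊎ v ∈ p₂ → v ∈ p₁ ++ p₂
        ∈-++ (inj₁ v∈p₁) = ∈-++⁺ˡ v∈p₁
        ∈-++ (inj₂ v∈p₂) = ∈-++⁺ʳ p₁ v∈p₂

      inner-unique : Unique inner
      inner-unique = Uniqueₚ.filter⁺ (¬? ∘ terminal?) (deduplicate-! ℕ._≟_ (p₁ ++ p₂))

      predecessor-in-H : ∀ {v} → v ∈ p₁ ⊎ v ∈ p₂ → ¬ Terminal v → ∃[ x ] (x , v) ∈ H
      predecessor-in-H (inj₁ v∈p₁) ¬terminal =
        Product.map₂ (∈H⁺ ∘ inj₁) (predecessor-exists w₁ v∈p₁ (¬terminal ∘ inj₁))
      predecessor-in-H (inj₂ v∈p₂) ¬terminal =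
        Product.map₂ (∈H⁺ ∘ inj₂) (predecessor-exists w₂ v∈p₂ (¬terminal ∘ inj₂))

      var-lit∈x₀∷inner : ∀ {u} → u ∈ p₁ ⊎ u ∈ p₂ → var (lit u) ∈ x₀ ∷ inner
      var-lit∈x₀∷inner {u} u∈p with terminal? u
      ... | yes terminal = here (var-lit-terminal terminal)
      ... | no ¬terminal = there (subst (_∈ inner) (sym (var-lit-inner ¬terminal)) (∈inner⁺ u∈p ¬terminal))

      record Divergence : Set where
        field
          u a₁ a₂ : Var
          arc₁ : (a₁ , u) ∈ walkArcs w₁
          arc₂ : (a₂ , u) ∈ walkArcs w₂
          sources-differ : a₁ ≢ a₂

      SharedInner : Var → Set
      SharedInner v = v ∈ p₁ × v ∈ p₂ × ¬ Terminal v

      sharedInner? : ∀ v → Dec (SharedInner v)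
      sharedInner? v = (v ∈? p₁) ×-dec (v ∈? p₂) ×-dec ¬? (terminal? v)

      divergence-along : ∀ {a q} (w : Walk G a t q) → (∀ {e} → e ∈ walkArcs w → e ∈ walkArcs w₁) →
                         ¬ SharedInner a → ∀ {v} → v ∈ q → SharedInner v → Divergence
      divergence-along here _ ¬shared (here refl) shared = ⊥-elim (¬shared shared)
      divergence-along here _ _ (there ())
      divergence-along (step _ _) _ ¬shared (here refl) shared = ⊥-elim (¬shared shared)
      divergence-along (step {a} {b} _ w) w⊆w₁ ¬shared (there v∈q) shared with sharedInner? b
      ... | no ¬shared-b = divergence-along w (w⊆w₁ ∘ there) ¬shared-b v∈q shared
      ... | yes (_ , b∈p₂ , b-inner) with predecessor-exists w₂ b∈p₂ (b-inner ∘ inj₂)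
      ...   | x , xb∈w₂ with x ℕ.≟ a
      ...     | no x≢a = record { u = b ; a₁ = a ; a₂ = x ; arc₁ = w⊆w₁ (here refl) ; arc₂ = xb∈w₂
                                ; sources-differ = ≢-sym x≢a }
      ...     | yes refl = ⊥-elim (¬shared (proj₁ (walkArcs⊆vertices w₁ ab∈w₁) ,
                                            proj₁ (walkArcs⊆vertices w₂ xb∈w₂) , x-inner))
        where
        ab∈w₁ = w⊆w₁ (here refl)
        x-inner : ¬ Terminal x
        x-inner (inj₁ x≡s) = source≢end w₂ !p₂ xb∈w₂ x≡s
        x-inner (inj₂ x≡t) = source≢end w₁ !p₁ ab∈w₁ x≡t

      divergence-or-disjoint : Divergence ⊎ InternallyDisjoint p₁ p₂
      divergence-or-disjoint with any? sharedInner? p₁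
      ... | yes ∃shared = let _ , v∈p₁ , shared = find ∃shared in
                          inj₁ (divergence-along w₁ (λ e∈ → e∈) (λ (_ , _ , ¬terminal) → ¬terminal (inj₁ refl))
                                                 v∈p₁ shared)
      ... | no ∄shared = inj₂ λ v v∈p₁ v∈p₂ → decidable-stable (terminal? v) λ ¬terminal →
                           ∄shared (lose v∈p₁ (v∈p₁ , v∈p₂ , ¬terminal))

      cut-set : InternallyDisjoint p₁ p₂ → ∀ {e₀} → e₀ ∈ H →
                Σ[ R ∈ (Var → Bool) ] Separates R ×
                                      (∀ {a b} → (a , b) ∈ H → (a , b) ≢ e₀ → T (R a) → T (R b))
      cut-set disjoint e₀∈H with ∈H⁻ e₀∈H
      ... | inj₁ e₀∈w₁ =
            let r , s∈r , t∉r , closed = cut-cycle w₁ !p₁ w₂ !p₂ disjoint e₀∈w₁ in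
            (λ v → ⌊ v ∈? r ⌋) , separated {λ v → ⌊ v ∈? r ⌋} (fromWitness s∈r) (t∉r ∘ toWitness) ,
            λ ab∈H ≢e₀ a∈r → fromWitness (closed (∈H⁻ ab∈H) ≢e₀ (toWitness a∈r))
      ... | inj₂ e₀∈w₂ =
            let r , t∈r , s∉r , closed =
                  cut-cycle w₂ !p₂ w₁ !p₁ (λ v v∈p₂ v∈p₁ → Sum.swap (disjoint v v∈p₁ v∈p₂)) e₀∈w₂ in
            (λ v → ⌊ v ∈? r ⌋) , ≢-sym (separated {λ v → ⌊ v ∈? r ⌋} (fromWitness t∈r) (s∉r ∘ toWitness)) ,
            λ ab∈H ≢e₀ a∈r → fromWitness (closed (Sum.swap (∈H⁻ ab∈H)) ≢e₀ (toWitness a∈r))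

      satisfiable-without : InternallyDisjoint p₁ p₂ → ∀ k → Satisfiable (map clause (removeAt H k))
      satisfiable-without disjoint k with cut-set disjoint (∈-lookup k)
      ... | R , separates , closed =
            assignment R , closed⇒satisfied (λ ab∈ → x₀-free (H⊆E (rest⊆H ab∈))) separates
                                            (λ ab∈ → closed (rest⊆H ab∈) (proj₂ (∈-removeAt⁻ H-unique k ab∈)))
        where
        rest⊆H : ∀ {e} → e ∈ removeAt H k → e ∈ H
        rest⊆H e∈ = proj₁ (∈-removeAt⁻ H-unique k e∈)

      removal-satisfiable : InternallyDisjoint p₁ p₂ → ∀ i → Satisfiable (removeAt (map clause H) i)
      removal-satisfiable disjoint i = subst Satisfiable removeAt-map (satisfiable-without disjoint k)
        where
        k = cast (length-map clause H) i
        removeAt-map : map clause (removeAt H k) ≡ removeAt (map clause H) i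
        removeAt-map = trans (map-removeAt H k clause)
          (cong (removeAt (map clause H)) (cast-involutive (sym (length-map clause H)) (length-map clause H) i))

    record Decomposition (F′ : ClauseSet) : Set where
      field
        p₁ p₂ : List Var
        w₁ : Walk G s t p₁
        !p₁ : Unique p₁
        w₂ : Walk G t s p₂
        !p₂ : Unique p₂
        clauses⊆ : F′ ⊆ₛ map clause (pathArcs w₁ w₂)
        ⊆clauses : map clause (pathArcs w₁ w₂) ⊆ₛ F′

    module Decomposed {F′} (!F′ : UniqueClauses F′) (D : Decomposition F′) where
      open Decomposition D
      open TwoPaths w₁ !p₁ w₂ !p₂ public

      clause∈F′ : ∀ {e} → e ∈ H → clause e ∈ₛ F′
      clause∈F′ e∈H = ⊆clauses (∈ₛ-map⁺ e∈H ≈C-refl)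

      arc-of : ∀ {C} → C ∈ F′ → ∃[ e ] e ∈ H × C ≈C clause e
      arc-of C∈F′ = ∈ₛ-map⁻ (clauses⊆ (∈⇒∈ₛ C∈F′))

      ldeg-≤-arcs : ∀ {l ys} → (∀ {e} → e ∈ H → l ∈ clause e → e ∈ ys) → ldeg F′ l ≤ length ys
      ldeg-≤-arcs {l} {ys} H→ys = ≤-trans (ldeg-≤ !F′ covered) (≤-reflexive (length-map clause ys))
        where
        covered : ∀ {C} → C ∈ F′ → l ∈ C → C ∈ₛ map clause ys
        covered C∈F′ l∈C =
          let e , e∈H , C≈e = arc-of C∈F′ in ∈ₛ-map⁺ (H→ys e∈H (proj₁ C≈e l∈C)) C≈e

      arcs-≤-ldeg : ∀ {l ys} → Unique ys → (∀ {e} → e ∈ ys → e ∈ H × l ∈ clause e) →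
                    length ys ≤ ldeg F′ l
      arcs-≤-ldeg {l} {ys} !ys ys→H =
        ≤-trans (≤-reflexive (sym (length-map clause ys)))
                (≤-ldeg (arcs-clauses-unique (H⊆E ∘ proj₁ ∘ ys→H) !ys) covered)
        where
        covered : ∀ {C} → C ∈ map clause ys → l ∈ C × C ∈ₛ F′
        covered C∈ with ∈-map⁻ clause C∈
        ... | e , e∈ys , refl = proj₂ (ys→H e∈ys) , clause∈F′ (proj₁ (ys→H e∈ys))

      ldeg-≡-arcs : ∀ {l ys} → Unique ys → (∀ {e} → e ∈ H → l ∈ clause e → e ∈ ys) →
                    (∀ {e} → e ∈ ys → e ∈ H × l ∈ clause e) → ldeg F′ l ≡ length ys
      ldeg-≡-arcs !ys H→ys ys→H = ≤-antisym (ldeg-≤-arcs H→ys) (arcs-≤-ldeg !ys ys→H)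

      target≢x₀ : ∀ {a b} → (a , b) ∈ H → b ≢ x₀
      target≢x₀ ab∈H = proj₂ (x₀-free (H⊆E ab∈H))

      source≢x₀ : ∀ {a b} → (a , b) ∈ H → a ≢ x₀
      source≢x₀ ab∈H = proj₁ (x₀-free (H⊆E ab∈H))

      ldeg-pos-x₀ : ldeg F′ (pos x₀) ≡ 2
      ldeg-pos-x₀ with first-arc₂ | last-arc₂
      ... | y , ty∈w₂ | z , zs∈w₂ = ldeg-≡-arcs ((ty≢zs ∷ []) ∷ [] ∷ []) complete sound
        where
        ty≢zs : (t , y) ≢ (z , s)
        ty≢zs eq = no-terminal-arc (walkArcs⊆E w₂ ty∈w₂) (inj₂ refl) (inj₁ (cong proj₂ eq))
        complete : ∀ {e} → e ∈ H → pos x₀ ∈ clause e → e ∈ (t , y) ∷ (z , s) ∷ []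
        complete {a , b} ab∈H pos∈ with pos-x₀∈clause⁻ {a} (target≢x₀ ab∈H) pos∈
        ... | inj₁ refl = there (here (cong (_, s) (H-into-s zs∈w₂ ab∈H)))
        ... | inj₂ refl = here (cong (t ,_) (H-out-of-t ty∈w₂ ab∈H))
        sound : ∀ {e} → e ∈ (t , y) ∷ (z , s) ∷ [] → e ∈ H × pos x₀ ∈ clause e
        sound (here refl) = ∈H⁺ (inj₂ ty∈w₂) , pos-x₀∈clause⁺ (inj₂ refl)
        sound (there (here refl)) = ∈H⁺ (inj₂ zs∈w₂) , pos-x₀∈clause⁺ {z} (inj₁ refl)

      ldeg-neg-x₀ : ldeg F′ (neg x₀) ≡ 2
      ldeg-neg-x₀ with first-arc₁ | last-arc₁
      ... | y , sy∈w₁ | z , zt∈w₁ = ldeg-≡-arcs ((sy≢zt ∷ []) ∷ [] ∷ []) complete sound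
        where
        sy≢zt : (s , y) ≢ (z , t)
        sy≢zt eq = no-terminal-arc (walkArcs⊆E w₁ sy∈w₁) (inj₁ refl) (inj₂ (cong proj₂ eq))
        complete : ∀ {e} → e ∈ H → neg x₀ ∈ clause e → e ∈ (s , y) ∷ (z , t) ∷ []
        complete {a , b} ab∈H neg∈ with neg-x₀∈clause⁻ {b = b} (source≢x₀ ab∈H) neg∈
        ... | inj₁ refl = here (cong (s ,_) (H-out-of-s sy∈w₁ ab∈H))
        ... | inj₂ refl = there (here (cong (_, t) (H-into-t zt∈w₁ ab∈H)))
        sound : ∀ {e} → e ∈ (s , y) ∷ (z , t) ∷ [] → e ∈ H × neg x₀ ∈ clause e
        sound (here refl) = ∈H⁺ (inj₁ sy∈w₁) , neg-x₀∈clause⁺ (inj₁ refl)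
        sound (there (here refl)) = ∈H⁺ (inj₁ zt∈w₁) , neg-x₀∈clause⁺ {z} (inj₂ refl)

      vdeg-x₀ : vdeg F′ x₀ ≡ 4
      vdeg-x₀ = cong₂ _+_ ldeg-pos-x₀ ldeg-neg-x₀

      vars⊆x₀∷inner : ∀ {v} → v ∈ vars F′ → v ∈ x₀ ∷ inner
      vars⊆x₀∷inner v∈ with ∈-vars⁻ v∈
      ... | C , C∈F′ , l , l∈C , refl with arc-of C∈F′
      ...   | (a , b) , ab∈H , C≈ab with ∈-clause⁻ a b (proj₁ C≈ab l∈C)
      ...     | inj₁ refl = var-lit∈x₀∷inner (proj₁ (H-endpoints ab∈H))
      ...     | inj₂ refl = var-lit∈x₀∷inner (proj₂ (H-endpoints ab∈H))

      x₀∈vars : x₀ ∈ vars F′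
      x₀∈vars with first-arc₁
      ... | y , sy∈w₁ = ∈-vars⁺ (clause∈F′ (∈H⁺ (inj₁ sy∈w₁))) (neg-x₀∈clause⁺ {b = y} (inj₁ refl))

      nVars≤ : nVars F′ ≤ suc (length inner)
      nVars≤ =
        Unique⇒length-≤ (≡.setoid Var) (deduplicate-! ℕ._≟_ (concatMap (map var) F′)) vars⊆x₀∷inner

      arcs≤clauses : length H ≤ length F′
      arcs≤clauses = ≤-trans (≤-reflexive (sym (length-map clause H)))
                             (Unique⇒length-≤ ClauseSetoid (arcs-clauses-unique H⊆E H-unique) ⊆clauses)

      vdeg-on-one-path : ∀ {a b p v} (w : Walk G a b p) → Unique p → Terminal a → Terminal b →
                         (∀ {e} → e ∈ walkArcs w → e ∈ H) → v ∈ p → ¬ Terminal v →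
                         (∀ {x y} → (x , y) ∈ H → x ≡ v ⊎ y ≡ v → (x , y) ∈ walkArcs w) → vdeg F′ v ≡ 2
      vdeg-on-one-path {v = v} w !p a-terminal b-terminal w⊆H v∈p ¬terminal touching
        with predecessor-exists w v∈p (λ { refl → ¬terminal a-terminal })
           | successor-exists w v∈p (λ { refl → ¬terminal b-terminal })
      ... | x , xv∈w | y , vy∈w = cong₂ _+_ in-degree out-degree
        where
        v≢x₀ : v ≢ x₀
        v≢x₀ = target≢x₀ (w⊆H xv∈w)
        in-degree : ldeg F′ (pos v) ≡ 1
        in-degree =
          ldeg-≡-arcs ([] ∷ []) complete λ { (here refl) → w⊆H xv∈w , pos∈clause⁺ {a = x} ¬terminal }
          where
          complete : ∀ {e} → e ∈ H → pos v ∈ clause e → e ∈ (x , v) ∷ []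
          complete {a′ , b′} e∈H pos∈ with pos∈clause⁻ {a = a′} {b′} v≢x₀ pos∈
          ... | refl = here (cong (_, v) (predecessor-unique w !p (touching e∈H (inj₂ refl)) xv∈w))
        out-degree : ldeg F′ (neg v) ≡ 1
        out-degree = ldeg-≡-arcs ([] ∷ []) complete λ { (here refl) → w⊆H vy∈w , neg∈clause⁺ ¬terminal }
          where
          complete : ∀ {e} → e ∈ H → neg v ∈ clause e → e ∈ (v , y) ∷ []
          complete {a′ , b′} e∈H neg∈ with neg∈clause⁻ {a = a′} {b′} v≢x₀ neg∈
          ... | refl = here (cong (v ,_) (successor-unique w !p (touching e∈H (inj₁ refl)) vy∈w))

      module _ (disjoint : InternallyDisjoint p₁ p₂) where

        vdeg-inner : ∀ {v} → v ∈ inner → vdeg F′ v ≡ 2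
        vdeg-inner {v} v∈inner with ∈inner⁻ v∈inner
        ... | inj₁ v∈p₁ , ¬terminal =
              vdeg-on-one-path w₁ !p₁ (inj₁ refl) (inj₂ refl) (∈H⁺ ∘ inj₁) v∈p₁ ¬terminal touching
          where
          touching : ∀ {x y} → (x , y) ∈ H → x ≡ v ⊎ y ≡ v → (x , y) ∈ walkArcs w₁
          touching xy∈H x≡v⊎y≡v with ∈H⁻ xy∈H
          ... | inj₁ xy∈w₁ = xy∈w₁
          ... | inj₂ xy∈w₂ = ⊥-elim (¬terminal (disjoint v v∈p₁ (endpoint∈ w₂ xy∈w₂ x≡v⊎y≡v)))
        ... | inj₂ v∈p₂ , ¬terminal =
              vdeg-on-one-path w₂ !p₂ (inj₂ refl) (inj₁ refl) (∈H⁺ ∘ inj₂) v∈p₂ ¬terminal touching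
          where
          touching : ∀ {x y} → (x , y) ∈ H → x ≡ v ⊎ y ≡ v → (x , y) ∈ walkArcs w₂
          touching xy∈H x≡v⊎y≡v with ∈H⁻ xy∈H
          ... | inj₁ xy∈w₁ = ⊥-elim (¬terminal (disjoint v (endpoint∈ w₁ xy∈w₁ x≡v⊎y≡v) v∈p₂))
          ... | inj₂ xy∈w₂ = xy∈w₂

        degree-of-var : ∀ {v} → v ∈ vars F′ → v ≡ x₀ × vdeg F′ v ≡ 4 ⊎ vdeg F′ v ≡ 2
        degree-of-var v∈ with vars⊆x₀∷inner v∈
        ... | here refl = inj₁ (refl , vdeg-x₀)
        ... | there v∈inner = inj₂ (vdeg-inner v∈inner)

        no-vertex-of-degree-3 : nDeg 3 F′ ≡ 0
        no-vertex-of-degree-3 = n≤0⇒n≡0 (nDeg-≤ {F′} {3} {[]} impossible)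
          where
          impossible : ∀ {v} → v ∈ vars F′ → vdeg F′ v ≡ 3 → v ∈ []
          impossible v∈ deg≡3 with degree-of-var v∈
          ... | inj₁ (_ , deg≡4) = contradiction (trans (sym deg≡4) deg≡3) λ ()
          ... | inj₂ deg≡2 = contradiction (trans (sym deg≡2) deg≡3) λ ()

        one-vertex-of-degree-4 : nDeg 4 F′ ≡ 1
        one-vertex-of-degree-4 =
          ≤-antisym (nDeg-≤ {F′} {4} {x₀ ∷ []} only-x₀)
                    (≤-nDeg {F′} {4} {x₀ ∷ []} ([] ∷ []) λ { (here refl) → x₀∈vars , vdeg-x₀ })
          where
          only-x₀ : ∀ {v} → v ∈ vars F′ → vdeg F′ v ≡ 4 → v ∈ x₀ ∷ []
          only-x₀ v∈ deg≡4 with degree-of-var v∈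
          ... | inj₁ (refl , _) = here refl
          ... | inj₂ deg≡2 = contradiction (trans (sym deg≡2) deg≡4) λ ()

      special-cycle-or-divergence : SpecialCycle s t G ⊎ Divergence
      special-cycle-or-divergence with divergence-or-disjoint
      ... | inj₁ divergence = inj₂ divergence
      ... | inj₂ disjoint = inj₁ (p₁ , p₂ , (w₁ , !p₁) , (w₂ , !p₂) , disjoint)

      module _ (divergence : Divergence) where
        open Divergence divergence

        u-inner : ¬ Terminal u
        u-inner (inj₁ u≡s) = target≢start w₁ !p₁ arc₁ u≡s
        u-inner (inj₂ u≡t) = target≢start w₂ !p₂ arc₂ u≡t

        u≢x₀ : u ≢ x₀
        u≢x₀ = target≢x₀ (∈H⁺ (inj₁ arc₁))

        u∈vars : u ∈ vars F′
        u∈vars = ∈-vars⁺ (clause∈F′ (∈H⁺ (inj₁ arc₁))) (pos∈clause⁺ {a = a₁} u-inner)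

        ldeg-pos-u : ldeg F′ (pos u) ≡ 2
        ldeg-pos-u = ldeg-≡-arcs (((λ eq → sources-differ (cong proj₁ eq)) ∷ []) ∷ [] ∷ []) complete sound
          where
          complete : ∀ {e} → e ∈ H → pos u ∈ clause e → e ∈ (a₁ , u) ∷ (a₂ , u) ∷ []
          complete {a , b} ab∈H pos∈ with pos∈clause⁻ {a = a} {b} u≢x₀ pos∈
          ... | refl with ∈H⁻ ab∈H
          ...   | inj₁ au∈w₁ = here (cong (_, u) (predecessor-unique w₁ !p₁ au∈w₁ arc₁))
          ...   | inj₂ au∈w₂ = there (here (cong (_, u) (predecessor-unique w₂ !p₂ au∈w₂ arc₂)))
          sound : ∀ {e} → e ∈ (a₁ , u) ∷ (a₂ , u) ∷ [] → e ∈ H × pos u ∈ clause e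
          sound (here refl) = ∈H⁺ (inj₁ arc₁) , pos∈clause⁺ {a = a₁} u-inner
          sound (there (here refl)) = ∈H⁺ (inj₂ arc₂) , pos∈clause⁺ {a = a₂} u-inner

        ldeg-neg-u : ldeg F′ (neg u) ≡ 1 ⊎ ldeg F′ (neg u) ≡ 2
        ldeg-neg-u with successor-exists w₁ (proj₂ (walkArcs⊆vertices w₁ arc₁)) (u-inner ∘ inj₂)
                      | successor-exists w₂ (proj₂ (walkArcs⊆vertices w₂ arc₂)) (u-inner ∘ inj₁)
        ... | b₁ , ub₁∈w₁ | b₂ , ub₂∈w₂ =
              between-1-and-2
                (arcs-≤-ldeg ([] ∷ []) λ { (here refl) → ∈H⁺ (inj₁ ub₁∈w₁) , neg∈clause⁺ {b = b₁} u-inner })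
                (ldeg-≤-arcs complete)
          where
          complete : ∀ {e} → e ∈ H → neg u ∈ clause e → e ∈ (u , b₁) ∷ (u , b₂) ∷ []
          complete {a , b} ab∈H neg∈ with neg∈clause⁻ {a = a} {b} u≢x₀ neg∈
          ... | refl with ∈H⁻ ab∈H
          ...   | inj₁ ub∈w₁ = here (cong (u ,_) (successor-unique w₁ !p₁ ub∈w₁ ub₁∈w₁))
          ...   | inj₂ ub∈w₂ = there (here (cong (u ,_) (successor-unique w₂ !p₂ ub∈w₂ ub₂∈w₂)))

        vdeg-u : vdeg F′ u ≡ 3 ⊎ vdeg F′ u ≡ 4
        vdeg-u = Sum.map (cong₂ _+_ ldeg-pos-u) (cong₂ _+_ ldeg-pos-u) ldeg-neg-u

        not-FamilyIII-degrees : nDeg 3 F′ ≡ 0 → nDeg 4 F′ ≡ 1 → ⊥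
        not-FamilyIII-degrees no-deg-3 one-deg-4 = [ degree-3 , degree-4 ] vdeg-u
          where
          degree-3 : vdeg F′ u ≡ 3 → ⊥
          degree-3 deg≡3 = contradiction
            (subst (1 ≤_) no-deg-3 (≤-nDeg {F′} {3} {u ∷ []} ([] ∷ []) λ { (here refl) → u∈vars , deg≡3 }))
            λ ()
          degree-4 : vdeg F′ u ≡ 4 → ⊥
          degree-4 deg≡4 = contradiction
            (subst (2 ≤_) one-deg-4 (≤-nDeg {F′} {4} {x₀ ∷ u ∷ []} (((u≢x₀ ∘ sym) ∷ []) ∷ [] ∷ [])
              λ { (here refl) → x₀∈vars , vdeg-x₀ ; (there (here refl)) → u∈vars , deg≡4 }))
            λ { (s≤s ()) }

        three+inner≤arcs : 3 + length inner ≤ length H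
        three+inner≤arcs = begin
          suc (length (s ∷ t ∷ inner))
            ≤⟨ s≤s (Unique⇒length-≤ (≡.setoid Var) targets-unique targets⊆) ⟩
          suc (length (map proj₂ (removeAt H k))) ≡⟨ cong suc (length-map proj₂ (removeAt H k)) ⟩
          suc (length (removeAt H k))             ≡⟨ length-removeAt′ H k ⟨
          length H                                ∎
          where
          open ≤-Reasoning
          e₀∈H = ∈H⁺ (inj₂ arc₂)
          k = Any.index e₀∈H
          targets-unique : Unique (s ∷ t ∷ inner)
          targets-unique = (s≢t ∷ All.tabulate (λ v∈ s≡v → proj₂ (∈inner⁻ v∈) (inj₁ (sym s≡v))))
                         ∷ All.tabulate (λ v∈ t≡v → proj₂ (∈inner⁻ v∈) (inj₂ (sym t≡v)))
                         ∷ inner-unique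
          target∈ : ∀ {x v} → (x , v) ∈ H → (x , v) ≢ (a₂ , u) → v ∈ map proj₂ (removeAt H k)
          target∈ xv∈H ≢e₀ = ∈-map⁺ proj₂ (∈-removeAt⁺ (≡.setoid Arc) e₀∈H xv∈H (≢-sym ≢e₀))
          targets⊆ : ∀ {v} → v ∈ s ∷ t ∷ inner → v ∈ map proj₂ (removeAt H k)
          targets⊆ (here refl) with last-arc₂
          ... | z , zs∈w₂ = target∈ (∈H⁺ (inj₂ zs∈w₂)) (λ eq → u-inner (inj₁ (sym (cong proj₂ eq))))
          targets⊆ (there (here refl)) with last-arc₁
          ... | z , zt∈w₁ = target∈ (∈H⁺ (inj₁ zt∈w₁)) (λ eq → u-inner (inj₂ (sym (cong proj₂ eq))))
          targets⊆ (there (there v∈inner))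
            with predecessor-in-H (proj₁ (∈inner⁻ v∈inner)) (proj₂ (∈inner⁻ v∈inner))
          ... | x , xv∈H with (x , _) ≟A (a₂ , u)
          ...   | no ≢e₀ = target∈ xv∈H ≢e₀
          ...   | yes refl = target∈ (∈H⁺ (inj₁ arc₁)) (λ eq → sources-differ (cong proj₁ eq))

        two≤deficiency : + 2 ≤ℤ deficiency F′
        two≤deficiency = 2≤deficiency {F′} (begin
          2 + nVars F′     ≤⟨ +-monoʳ-≤ 2 nVars≤ ⟩
          3 + length inner ≤⟨ three+inner≤arcs ⟩
          length H         ≤⟨ arcs≤clauses ⟩
          length F′        ∎)
          where open ≤-Reasoning

    module Cycle {p₁ p₂} (w₁ : Walk G s t p₁) (!p₁ : Unique p₁) (w₂ : Walk G t s p₂) (!p₂ : Unique p₂)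
                 (disjoint : InternallyDisjoint p₁ p₂) where
      open TwoPaths w₁ !p₁ w₂ !p₂

      cycle-clauses-unique : UniqueClauses (map clause H)
      cycle-clauses-unique = arcs-clauses-unique H⊆E H-unique

      cycle-decomposition : Decomposition (map clause H)
      cycle-decomposition = record
        { p₁ = p₁ ; p₂ = p₂ ; w₁ = w₁ ; !p₁ = !p₁ ; w₂ = w₂ ; !p₂ = !p₂
        ; clauses⊆ = λ C∈ → C∈ ; ⊆clauses = λ C∈ → C∈
        }

      open Decomposed cycle-clauses-unique cycle-decomposition
        using (no-vertex-of-degree-3; one-vertex-of-degree-4)

      cycle-MU : MU (map clause H)
      cycle-MU = (Allₚ.map⁺ (All.tabulate (clause-isClause ∘ arc-proper ∘ H⊆E)) , cycle-clauses-unique) ,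
                 clauses-unsatisfiable , removal-satisfiable disjoint

      cycle-MUS : IsMUS (map clause H) (tFC s t x₀ G)
      cycle-MUS = Allₚ.map⁺ (All.tabulate λ e∈H → ∈ₛ-map⁺ (H⊆E e∈H) ≈C-refl) , cycle-MU

      cycle-FamilyIII : FamilyIII (map clause H)
      cycle-FamilyIII = cycle-MU , Allₚ.map⁺ (All.tabulate λ _ → ≤-refl) ,
                        no-vertex-of-degree-3 disjoint , one-vertex-of-degree-4 disjoint

    -- G′ keeps the arcs whose clause lies in F′; tFC(G′) ⊇ F′ is unsatisfiable, so G′ has a special
    -- closed walk, and by minimality F′ consists exactly of the clauses of its arcs.
    mus⇒decomposition : ∀ {F′} → IsMUS F′ (tFC s t x₀ G) → Decomposition F′
    mus⇒decomposition {F′} (F′⊆G , _ , unsat , removable) =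
      decomposition (unsatisfiable⇒special-closed-walk G′ (x₀-free ∘ G′⊆G) (unsat ∘ satisfiable-⊆ₛ F′⊆G′))
      where
      G′ : Digraph
      G′ = record { V = V G ; E = filter (λ e → clause e ∈ₛ? F′) (E G) }
      G′⊆G : ∀ {e} → e ∈ E G′ → e ∈ E G
      G′⊆G = proj₁ ∘ ∈-filter⁻ (λ e → clause e ∈ₛ? F′) {xs = E G}
      F′⊆G′ : F′ ⊆ₛ tFC s t x₀ G′
      F′⊆G′ C∈F′ with ∈ₛ-map⁻ (⊆CS⇒⊆ₛ F′⊆G C∈F′)
      ... | e , e∈E , C≈e =
            ∈ₛ-map⁺ (∈-filter⁺ (λ e → clause e ∈ₛ? F′) e∈E (∈ₛ-resp-≈C C≈e C∈F′)) C≈e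
      decomposition : SpecialClosedWalk s t G′ → Decomposition F′
      decomposition (p₁ , p₂ , (w₁′ , !p₁) , (w₂′ , !p₂)) = record
        { p₁ = p₁ ; p₂ = p₂ ; w₁ = w₁ ; !p₁ = !p₁ ; w₂ = w₂ ; !p₂ = !p₂
        ; clauses⊆ = unsatisfiable-subset-of-MU removable ⊆clauses clauses-unsatisfiable
        ; ⊆clauses = ⊆clauses
        }
        where
        w₁ = walk-⊆ G′⊆G w₁′
        w₂ = walk-⊆ G′⊆G w₂′
        open TwoPaths w₁ !p₁ w₂ !p₂ using (H; ∈H⁻; clauses-unsatisfiable)
        H⊆G′ : ∀ {e} → e ∈ H → e ∈ E G′
        H⊆G′ e∈H with ∈H⁻ e∈H
        ... | inj₁ e∈w₁ = walkArcs⊆E w₁′ (subst (_ ∈_) (walkArcs-walk-⊆ G′⊆G w₁′) e∈w₁)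
        ... | inj₂ e∈w₂ = walkArcs⊆E w₂′ (subst (_ ∈_) (walkArcs-walk-⊆ G′⊆G w₂′) e∈w₂)
        ⊆clauses : map clause H ⊆ₛ F′
        ⊆clauses C∈ with ∈ₛ-map⁻ C∈
        ... | e , e∈H , C≈e =
              ∈ₛ-resp-≈C (≈C-sym C≈e) (proj₂ (∈-filter⁻ (λ e → clause e ∈ₛ? F′) {xs = E G} (H⊆G′ e∈H)))

    module MUS {F′} (mus : IsMUS F′ (tFC s t x₀ G)) =
      Decomposed (proj₂ (proj₁ (proj₂ mus))) (mus⇒decomposition mus)

    special-cycle⇔FamilyIII-MUS : SpecialCycle s t G ⇔ (∃[ F′ ] IsMUS F′ (tFC s t x₀ G) × FamilyIII F′)
    special-cycle⇔FamilyIII-MUS = mk⇔ cycle⇒MUS MUS⇒cycle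
      where
      cycle⇒MUS : SpecialCycle s t G → ∃[ F′ ] IsMUS F′ (tFC s t x₀ G) × FamilyIII F′
      cycle⇒MUS (_ , _ , (w₁ , !p₁) , (w₂ , !p₂) , disjoint) = _ , cycle-MUS , cycle-FamilyIII
        where open Cycle w₁ !p₁ w₂ !p₂ disjoint
      MUS⇒cycle : ∃[ F′ ] IsMUS F′ (tFC s t x₀ G) × FamilyIII F′ → SpecialCycle s t G
      MUS⇒cycle (F′ , mus , _ , _ , no-deg-3 , one-deg-4) =
        [ id , (λ divergence → ⊥-elim (MUS.not-FamilyIII-degrees mus divergence no-deg-3 one-deg-4)) ]
          (MUS.special-cycle-or-divergence mus)

    no-special-cycle⇒2≤deficiency : ¬ SpecialCycle s t G →
                                    ∀ F′ → IsMUS F′ (tFC s t x₀ G) → + 2 ≤ℤ deficiency F′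
    no-special-cycle⇒2≤deficiency no-cycle F′ mus =
      [ ⊥-elim ∘ no-cycle , MUS.two≤deficiency mus ] (MUS.special-cycle-or-divergence mus)

theorem5p4 : (s t x₀ : Var) → s ≢ t → s ≢ x₀ → t ≢ x₀ →
    (G : Digraph) → IsStDigraph s t x₀ G →
    (¬ (HasIn G s × HasOut G s × HasIn G t × HasOut G t) → Satisfiable (tFC s t x₀ G))
    × (∀ F' → IsMUS F' (tFC s t x₀ G) → vdeg F' x₀ ≡ 4)
    × (SpecialClosedWalk s t G ⇔ (¬ Satisfiable (tFC s t x₀ G)))
    × (SpecialCycle s t G ⇔ (∃[ F' ] (IsMUS F' (tFC s t x₀ G) × FamilyIII F')))
    × (¬ SpecialCycle s t G → ∀ F' → IsMUS F' (tFC s t x₀ G) → + 2 ≤ℤ deficiency F')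
theorem5p4 s t x₀ s≢t s≢x₀ t≢x₀ G isG =
  missing-terminal-arc⇒satisfiable G (x₀-free G isG) ,
  (λ F′ mus → MUS.vdeg-x₀ G isG mus) ,
  special-closed-walk⇔unsatisfiable G (x₀-free G isG) ,
  special-cycle⇔FamilyIII-MUS G isG ,
  no-special-cycle⇒2≤deficiency G isG
  where open Translation s t x₀ s≢t s≢x₀ t≢x₀
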